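{- Let $d$ be even and let $X=(x_{ij})$ be an $n\times n$ matrix. Then $\det_d(\mathsf M^{(d)}_X)=\det(X)^n\,\det_d(\mathsf M^{(d)}_{I_n})$.
   Context: $\mathsf M^{(d)}_X\in(\mathbb C^{n^2})^{\otimes d}$ is the hypermatrix with $d$ modes indexed by pairs $(i,j)\in[n]^2$ and entries $(\mathsf M^{(d)}_X)_{(i_1,j_1),\dots,(i_d,j_d)}=\delta_{j_1=i_2}\delta_{j_2=i_3}\cdots\delta_{j_{d-1}=i_d}X_{i_1j_d}$. For a hypermatrix with $d$ modes indexed by an $N$-element set (identified with $[N]$, same bijection in all modes), $\det_d(T)=\frac1{N!}\sum_{\sigma_1,\dots,\sigma_d\in S_N}\mathrm{sgn}(\sigma_1)\cdots\mathrm{sgn}(\sigma_d)\prod_{i=1}^N T_{\sigma_1(i),\dots,\sigma_d(i)}$. -}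

module Defs where

open import Level using (_⊔_)
open import Data.Nat using (ℕ; zero; suc; _<ᵇ_) renaming (_*_ to _*ℕ_)
open import Data.Bool using (Bool; true; false; _∨_; _∧_; not; if_then_else_)
open import Data.Fin using (Fin; zero; suc; toℕ; inject₁; fromℕ; remQuot; _≟_)
open import Data.Fin.Properties using ()
open import Data.List using (List; []; _∷_; map; concatMap; foldr; filterᵇ; allFin; length)
open import Data.Bool.ListAction using (all)
open import Data.Product using (_×_; _,_; proj₁; proj₂)
open import Relation.Nullary.Decidable using (⌊_⌋)
open import Algebra.Bundles using (CommutativeRing)

allFunsL : ∀ {a} {A : Set a} (d : ℕ) → List A → List (Fin d → A)
allFunsL zero xs = (λ ()) ∷ []
allFunsL (suc d) xs =
  concatMap (λ x → map (λ f → λ { zero → x ; (suc k) → f k }) (allFunsL d xs)) xs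

pairOf : (n : ℕ) → Fin (n *ℕ n) → Fin n × Fin n
pairOf n a = remQuot {n} n a

injᵇ : ∀ {N} → (Fin N → Fin N) → Bool
injᵇ {N} σ = all (λ i → all (λ j → ⌊ i ≟ j ⌋ ∨ not ⌊ σ i ≟ σ j ⌋) (allFin N)) (allFin N)

perms : (N : ℕ) → List (Fin N → Fin N)
perms N = filterᵇ injᵇ (allFunsL N (allFin N))

inversions : ∀ {N} → (Fin N → Fin N) → ℕ
inversions {N} σ =
  length (filterᵇ (λ p → (toℕ (proj₁ p) <ᵇ toℕ (proj₂ p)) ∧ (toℕ (σ (proj₂ p)) <ᵇ toℕ (σ (proj₁ p))))
                  (concatMap (λ i → map (λ j → i , j) (allFin N)) (allFin N)))

module _ {c ℓ} (R : CommutativeRing c ℓ) where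
  open CommutativeRing R using (Carrier; _+_; _*_; -_; 0#; 1#)

  sumL : List Carrier → Carrier
  sumL = foldr _+_ 0#

  prodFin : (N : ℕ) → (Fin N → Carrier) → Carrier
  prodFin zero f = 1#
  prodFin (suc N) f = f zero * prodFin N (λ k → f (suc k))

  pow : Carrier → ℕ → Carrier
  pow x zero = 1#
  pow x (suc k) = x * pow x k

  negPow : ℕ → Carrier
  negPow zero = 1#
  negPow (suc k) = - negPow k

  sgn : ∀ {N} → (Fin N → Fin N) → Carrier
  sgn σ = negPow (inversions σ)

  δ : ∀ {n} → Fin n → Fin n → Carrier
  δ i j = if ⌊ i ≟ j ⌋ then 1# else 0#

  det : (n : ℕ) → (Fin n → Fin n → Carrier) → Carrier
  det n X = sumL (map (λ σ → sgn σ * prodFin n (λ i → X i (σ i))) (perms n))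

  -- N! · det_d(T) for a hypermatrix T with d modes indexed by Fin N:
  --   Σ_{σ_1..σ_d ∈ S_N} sgn σ_1 ⋯ sgn σ_d ∏_i T_{σ_1(i),…,σ_d(i)}
  -- (the factor 1/N! of det_d is cleared)
  detdN! : (d N : ℕ) → ((Fin d → Fin N) → Carrier) → Carrier
  detdN! d N T =
    sumL (map (λ σs → prodFin d (λ k → sgn (σs k)) * prodFin N (λ i → T (λ k → σs k i)))
              (allFunsL d (perms N)))

  -- The hypermatrix M^{(d)}_X for d = suc m modes, each indexed by [n]^2 ≅ Fin (n*n)
  -- via remQuot (a ↦ (i , j)).  Entry: δ_{j_1 i_2} ⋯ δ_{j_{d-1} i_d} X_{i_1 j_d}.
  MX : (m n : ℕ) → (Fin n → Fin n → Carrier) → (Fin (suc m) → Fin (n *ℕ n)) → Carrier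
  MX m n X v =
    prodFin m (λ k → δ (proj₂ (pairOf n (v (inject₁ k)))) (proj₁ (pairOf n (v (suc k)))))
    * X (proj₁ (pairOf n (v zero))) (proj₂ (pairOf n (v (fromℕ m))))

  idMat : (n : ℕ) → Fin n → Fin n → Carrier
  idMat n i j = δ i j

module Submission where

-- Evaluating the chain of δ's shows that M_X is M_I
-- multiplied in its last mode by the block-diagonal matrix B = I_n ⊗ X: M_X(w, b) = Σ_a M_I(w, a) B(a, b).
-- Expanding det_d along its last mode writes it as a signed sum of determinants of matrix slices, and each
-- slice of M_X is the corresponding slice of M_I times B.  Multiplicativity of det therefore gives
-- det_d(M_X) = det_d(M_I) · det B, and det B = det(X)^n block by block.
-- The determinant facts come from the Leibniz formula written as a sum over all maps Fin N → Fin N, weighted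
-- by the sign on injective maps and by 0 on the others; such sums are reindexed by permuting their indices
-- Fin (N ^ N).  The sign is multiplicative because it is a product over unordered pairs {i, j}, and that
-- product does not depend on which order is used to pick a representative (i, j) of each pair.

open import Algebra.Bundles using (CommutativeMonoid; CommutativeRing)
open import Data.Bool using (Bool; true; false; T; not; _∧_; _∨_; _xor_; if_then_else_)
open import Data.Bool.ListAction using (all)
open import Data.Bool.Properties using (xor-assoc; xor-same; xor-annihilates-not)
open import Data.Empty using (⊥-elim)
open import Data.Fin
  using (Fin; zero; suc; toℕ; _↑ˡ_; _↑ʳ_; inject₁; fromℕ; splitAt; remQuot; combine; finToFun; funToFin; _≟_; punchOut)
open import Data.Fin.Permutation as Perm using (Permutation; _⟨$⟩ʳ_; _⟨$⟩ˡ_; permutation; inverseˡ; inverseʳ)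
import Data.Fin.Permutation.Components as PC
open import Data.Fin.Properties
  using (toℕ-injective; toℕ<n; toℕ-↑ˡ; toℕ-↑ʳ; ↑ˡ-injective; ↑ʳ-injective; splitAt-↑ˡ; splitAt-↑ʳ; remQuot-combine;
         funToFin-finToFin; finToFun-funToFin; any?; injective⇒≤; punchOut-injective)
open import Data.List using (List; []; _∷_; _++_; map; concatMap; foldr; filterᵇ; allFin; length; tabulate)
open import Data.List.Membership.Propositional.Properties using (∈-allFin)
open import Data.List.Properties using (map-∘; map-tabulate)
open import Data.List.Relation.Unary.All as All using (All)
open import Data.List.Relation.Unary.All.Properties using (all⁺; all⁻)
open import Data.Nat as ℕ using (ℕ; zero; suc; _^_; _<ᵇ_)
import Data.Nat.Properties as ℕ
open import Data.Product using (_×_; _,_; proj₁; proj₂; ∃; ∃₂)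
open import Data.Sum using (_⊎_; inj₁; inj₂)
open import Data.Vec.Functional using (Vector; head; tail; init; last) renaming (_∷_ to _∷ᵥ_; _++_ to _++ᵥ_)
open import Data.Vec.Functional.Properties using (++-cong; ∷-cong; lookup-++ˡ; lookup-++ʳ)
open import Function using (_∘_; id)
open import Function.Definitions using (Injective)
open import Relation.Binary.Core using (_Preserves_⟶_)
open import Relation.Binary.PropositionalEquality as ≡ using (_≡_; _≢_; _≗_)
open import Relation.Nullary using (¬_; Dec; yes; no; does)
open import Relation.Nullary.Decidable
  using (⌊_⌋; ⌊⌋-map′; dec-true; dec-false; map′; T?; decidable-stable; ¬?; _×-dec_)
open import Defs

module _ {a} {A : Set a} where

  infixl 5 _∷ʳ_
  _∷ʳ_ : ∀ {n} → Vector A n → A → Vector A (suc n)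
  _∷ʳ_ {zero}  xs x = λ _ → x
  _∷ʳ_ {suc n} xs x = head xs ∷ᵥ (tail xs ∷ʳ x)

  init-∷ʳ : ∀ {n} (xs : Vector A n) x → init (xs ∷ʳ x) ≗ xs
  init-∷ʳ {suc n} xs x zero    = ≡.refl
  init-∷ʳ {suc n} xs x (suc k) = init-∷ʳ (tail xs) x k

  last-∷ʳ : ∀ {n} (xs : Vector A n) x → last (xs ∷ʳ x) ≡ x
  last-∷ʳ {zero}  xs x = ≡.refl
  last-∷ʳ {suc n} xs x = last-∷ʳ (tail xs) x

  ∷ʳ-cong : ∀ {n} {xs ys : Vector A n} x → xs ≗ ys → xs ∷ʳ x ≗ ys ∷ʳ x
  ∷ʳ-cong {zero}  x eq k       = ≡.refl
  ∷ʳ-cong {suc n} x eq zero    = eq zero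
  ∷ʳ-cong {suc n} x eq (suc k) = ∷ʳ-cong x (eq ∘ suc) k

  ∷-++ : ∀ {p q} x (g : Vector A p) (h : Vector A q) → (x ∷ᵥ g) ++ᵥ h ≗ x ∷ᵥ (g ++ᵥ h)
  ∷-++ {p} x g h zero = ≡.refl
  ∷-++ {p} x g h (suc i) with splitAt p i
  ... | inj₁ _ = ≡.refl
  ... | inj₂ _ = ≡.refl

module _ {a b} {A : Set a} {B : Set b} (e : A → B) where

  ∘-∷ʳ : ∀ {n} (xs : Vector A n) x → e ∘ (xs ∷ʳ x) ≗ (e ∘ xs) ∷ʳ e x
  ∘-∷ʳ {zero}  xs x k       = ≡.refl
  ∘-∷ʳ {suc n} xs x zero    = ≡.refl
  ∘-∷ʳ {suc n} xs x (suc k) = ∘-∷ʳ (tail xs) x k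

  ∘-∷ : ∀ {n} x (g : Vector A n) → e ∘ (x ∷ᵥ g) ≗ e x ∷ᵥ (e ∘ g)
  ∘-∷ x g zero    = ≡.refl
  ∘-∷ x g (suc k) = ≡.refl

↑ˡ≢↑ʳ : ∀ {p q} (i : Fin p) (j : Fin q) → i ↑ˡ q ≢ p ↑ʳ j
↑ˡ≢↑ʳ {p} {q} i j eq
  with () ← ≡.trans (≡.sym (splitAt-↑ˡ p i q)) (≡.trans (≡.cong (splitAt p) eq) (splitAt-↑ʳ p q j))

↑-cases : ∀ p {q} (a : Fin (p ℕ.+ q)) → (∃ λ i → a ≡ i ↑ˡ q) ⊎ (∃ λ j → a ≡ p ↑ʳ j)
↑-cases zero    a       = inj₂ (a , ≡.refl)
↑-cases (suc p) zero    = inj₁ (zero , ≡.refl)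
↑-cases (suc p) (suc a) with ↑-cases p a
... | inj₁ (i , ≡.refl) = inj₁ (suc i , ≡.refl)
... | inj₂ (j , ≡.refl) = inj₂ (j , ≡.refl)

remQuot-↑ˡ : ∀ {k} n (y : Fin n) → remQuot {suc k} n (y ↑ˡ (k ℕ.* n)) ≡ (zero , y)
remQuot-↑ˡ n y = remQuot-combine zero y

remQuot-↑ʳ : ∀ {k} n (z : Fin (k ℕ.* n)) →
             remQuot {suc k} n (n ↑ʳ z) ≡ (suc (proj₁ (remQuot {k} n z)) , proj₂ (remQuot {k} n z))
remQuot-↑ʳ {k} n z rewrite splitAt-↑ʳ n (k ℕ.* n) z = ≡.refl

funToFin-cong : ∀ {m n} {f g : Fin m → Fin n} → f ≗ g → funToFin f ≡ funToFin g
funToFin-cong {zero}  eq = ≡.refl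
funToFin-cong {suc m} eq = ≡.cong₂ combine (eq zero) (funToFin-cong (eq ∘ suc))

finToFun-combine : ∀ {m n} (x : Fin m) (i : Fin (m ^ n)) → finToFun {m} {suc n} (combine x i) ≗ x ∷ᵥ finToFun i
finToFun-combine x i zero    = ≡.cong proj₁ (remQuot-combine x i)
finToFun-combine x i (suc j) = ≡.cong (λ r → finToFun (proj₂ r) j) (remQuot-combine x i)

module _ {m n : ℕ} where

  -- precomposition with ρ⁻¹, transported to the indices Fin (m ^ n) of the maps Fin n → Fin m
  precompose : Permutation n n → Permutation (m ^ n) (m ^ n)
  precompose ρ = permutation (act (ρ ⟨$⟩ˡ_)) (act (ρ ⟨$⟩ʳ_))
                             (act-cancel (ρ ⟨$⟩ˡ_) (ρ ⟨$⟩ʳ_) (λ _ → inverseʳ ρ))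
                             (act-cancel (ρ ⟨$⟩ʳ_) (ρ ⟨$⟩ˡ_) (λ _ → inverseˡ ρ))
    where
    act : (Fin n → Fin n) → Fin (m ^ n) → Fin (m ^ n)
    act r i = funToFin (finToFun i ∘ r)
    act-cancel : ∀ r s → (∀ t → s (r t) ≡ t) → ∀ i → act r (act s i) ≡ i
    act-cancel r s sr i = ≡.trans (funToFin-cong λ t → ≡.trans (finToFun-funToFin _ (r t)) (≡.cong (finToFun i) (sr t)))
                                  (funToFin-finToFin {n} {m} i)

  finToFun-precompose : ∀ (ρ : Permutation n n) i → finToFun (precompose ρ ⟨$⟩ʳ i) ≗ finToFun i ∘ (ρ ⟨$⟩ˡ_)
  finToFun-precompose ρ i = finToFun-funToFin _

<ᵇ-irrefl : ∀ n → (n <ᵇ n) ≡ false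
<ᵇ-irrefl zero    = ≡.refl
<ᵇ-irrefl (suc n) = <ᵇ-irrefl n

<ᵇ-flip : ∀ m n → m ≢ n → (n <ᵇ m) ≡ not (m <ᵇ n)
<ᵇ-flip zero    zero    m≢n = ⊥-elim (m≢n ≡.refl)
<ᵇ-flip zero    (suc n) m≢n = ≡.refl
<ᵇ-flip (suc m) zero    m≢n = ≡.refl
<ᵇ-flip (suc m) (suc n) m≢n = <ᵇ-flip m n (m≢n ∘ ≡.cong suc)

<ᵇ-asym : ∀ m n → (m <ᵇ n) ≡ true → (n <ᵇ m) ≡ false
<ᵇ-asym m n m<n = ≡.trans (<ᵇ-flip m n m≢n) (≡.cong not m<n)
  where
  m≢n : m ≢ n
  m≢n ≡.refl with () ← ≡.trans (≡.sym (<ᵇ-irrefl m)) m<n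

+-<ᵇ-+ : ∀ p m n → (p ℕ.+ m <ᵇ p ℕ.+ n) ≡ (m <ᵇ n)
+-<ᵇ-+ zero    m n = ≡.refl
+-<ᵇ-+ (suc p) m n = +-<ᵇ-+ p m n

+-<ᵇ-false : ∀ p m n → n ℕ.< p → (p ℕ.+ m <ᵇ n) ≡ false
+-<ᵇ-false (suc p) m zero    n<p = ≡.refl
+-<ᵇ-false (suc p) m (suc n) n<p = +-<ᵇ-false p m n (ℕ.s<s⁻¹ n<p)

-- Injective endomaps of Fin n

module _ {n : ℕ} where

  Inj : (Fin n → Fin n) → Set
  Inj = Injective _≡_ _≡_

  injᵇ-sound : ∀ {σ} → T (injᵇ σ) → Inj σ
  injᵇ-sound {σ} t {i} {j} σi≡σj with i ≟ j | σ i ≟ σ j | entry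
    where
    entry : T (⌊ i ≟ j ⌋ ∨ not ⌊ σ i ≟ σ j ⌋)
    entry = All.lookup (all⁺ _ _ (All.lookup (all⁺ _ _ t) (∈-allFin i))) (∈-allFin j)
  ... | yes i≡j | _        | _ = i≡j
  ... | no _    | no σi≢σj | _ = ⊥-elim (σi≢σj σi≡σj)

  injᵇ-complete : ∀ {σ} → Inj σ → T (injᵇ σ)
  injᵇ-complete {σ} σ-inj =
    all⁻ row {allFin n} (All.tabulate λ {i} _ → all⁻ (entry i) {allFin n} (All.tabulate λ {j} _ → entry-true i j))
    where
    entry : Fin n → Fin n → Bool
    entry i j = ⌊ i ≟ j ⌋ ∨ not ⌊ σ i ≟ σ j ⌋
    row : Fin n → Bool
    row i = all (entry i) (allFin n)
    entry-true : ∀ i j → T (entry i j)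
    entry-true i j with i ≟ j | σ i ≟ σ j
    ... | yes _  | _         = _
    ... | no _   | no _      = _
    ... | no i≢j | yes σi≡σj = i≢j (σ-inj σi≡σj)

  injective? : ∀ σ → Dec (Inj σ)
  injective? σ = map′ injᵇ-sound injᵇ-complete (T? (injᵇ σ))

  ¬injective⇒collision : ∀ {f : Fin n → Fin n} → ¬ Inj f → ∃₂ λ p q → p ≢ q × f p ≡ f q
  ¬injective⇒collision {f} ¬f-inj with any? (λ p → any? (λ q → ¬? (p ≟ q) ×-dec (f p ≟ f q)))
  ... | yes (p , q , p≢q , fp≡fq) = p , q , p≢q , fp≡fq
  ... | no none = ⊥-elim (¬f-inj λ {p} {q} fp≡fq → decidable-stable (p ≟ q) (λ p≢q → none (p , q , p≢q , fp≡fq)))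

injective⇒surjective : ∀ {n} {σ : Fin n → Fin n} → Inj σ → ∀ y → ∃ λ x → σ x ≡ y
injective⇒surjective {suc n} {σ} σ-inj y with any? (λ x → σ x ≟ y)
... | yes hit = hit
... | no miss = ⊥-elim (ℕ.<-irrefl ≡.refl (injective⇒≤ punchOut-injective′))
  where
  y≢σ : ∀ x → y ≢ σ x
  y≢σ x y≡σx = miss (x , ≡.sym y≡σx)
  punchOut-injective′ : Injective _≡_ _≡_ (λ x → punchOut (y≢σ x))
  punchOut-injective′ {x} {x′} eq = σ-inj (punchOut-injective (y≢σ x) (y≢σ x′) eq)

injective⇒permutation : ∀ {n} {σ : Fin n → Fin n} → Inj σ → Permutation n n
injective⇒permutation {σ = σ} σ-inj =
  permutation σ (proj₁ ∘ surj) (proj₂ ∘ surj) (λ x → σ-inj (proj₂ (surj (σ x))))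
  where surj = injective⇒surjective σ-inj

∘-injectiveʳ : ∀ {n} {σ π : Fin n → Fin n} → Inj (σ ∘ π) → Inj π
∘-injectiveʳ {σ = σ} σπ-inj eq = σπ-inj (≡.cong σ eq)

∘-injectiveˡ : ∀ {n} {σ π : Fin n → Fin n} → Inj π → Inj (σ ∘ π) → Inj σ
∘-injectiveˡ {σ = σ} {π} π-inj σπ-inj {x} {y} eq with injective⇒surjective π-inj x | injective⇒surjective π-inj y
... | x′ , ≡.refl | y′ , ≡.refl = ≡.cong π (σπ-inj eq)

Inj-resp-≗ : ∀ {n} {σ τ : Fin n → Fin n} → σ ≗ τ → Inj σ → Inj τ
Inj-resp-≗ σ≗τ σ-inj eq = σ-inj (≡.trans (σ≗τ _) (≡.trans eq (≡.sym (σ≗τ _))))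

module _ {p q : ℕ} where

  _⊕_ : (Fin p → Fin p) → (Fin q → Fin q) → Fin (p ℕ.+ q) → Fin (p ℕ.+ q)
  g ⊕ h = ((_↑ˡ q) ∘ g) ++ᵥ ((p ↑ʳ_) ∘ h)

  module _ (g : Fin p → Fin p) (h : Fin q → Fin q) where

    ⊕-↑ˡ : ∀ i → (g ⊕ h) (i ↑ˡ q) ≡ g i ↑ˡ q
    ⊕-↑ˡ = lookup-++ˡ ((_↑ˡ q) ∘ g) ((p ↑ʳ_) ∘ h)

    ⊕-↑ʳ : ∀ j → (g ⊕ h) (p ↑ʳ j) ≡ p ↑ʳ h j
    ⊕-↑ʳ = lookup-++ʳ ((_↑ˡ q) ∘ g) ((p ↑ʳ_) ∘ h)

    ⊕-injective : Inj g → Inj h → Inj (g ⊕ h)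
    ⊕-injective g-inj h-inj {a} {b} eq with ↑-cases p a | ↑-cases p b
    ... | inj₁ (i , ≡.refl) | inj₁ (i′ , ≡.refl) =
      ≡.cong (_↑ˡ q) (g-inj (↑ˡ-injective q _ _ (≡.trans (≡.sym (⊕-↑ˡ i)) (≡.trans eq (⊕-↑ˡ i′)))))
    ... | inj₂ (j , ≡.refl) | inj₂ (j′ , ≡.refl) =
      ≡.cong (p ↑ʳ_) (h-inj (↑ʳ-injective p _ _ (≡.trans (≡.sym (⊕-↑ʳ j)) (≡.trans eq (⊕-↑ʳ j′)))))
    ... | inj₁ (i , ≡.refl) | inj₂ (j , ≡.refl) =
      ⊥-elim (↑ˡ≢↑ʳ _ _ (≡.trans (≡.sym (⊕-↑ˡ i)) (≡.trans eq (⊕-↑ʳ j))))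
    ... | inj₂ (j , ≡.refl) | inj₁ (i , ≡.refl) =
      ⊥-elim (↑ˡ≢↑ʳ _ _ (≡.trans (≡.sym (⊕-↑ˡ i)) (≡.trans (≡.sym eq) (⊕-↑ʳ j))))

    ⊕-injectiveˡ : Inj (g ⊕ h) → Inj g
    ⊕-injectiveˡ gh-inj {i} {i′} eq =
      ↑ˡ-injective q _ _ (gh-inj (≡.trans (⊕-↑ˡ i) (≡.trans (≡.cong (_↑ˡ q) eq) (≡.sym (⊕-↑ˡ i′)))))

    ⊕-injectiveʳ : Inj (g ⊕ h) → Inj h
    ⊕-injectiveʳ gh-inj {j} {j′} eq =
      ↑ʳ-injective p _ _ (gh-inj (≡.trans (⊕-↑ʳ j) (≡.trans (≡.cong (p ↑ʳ_) eq) (≡.sym (⊕-↑ʳ j′)))))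

module _ {n : ℕ} (i j : Fin n) where

  transpose-matchˡ : PC.transpose i j i ≡ j
  transpose-matchˡ rewrite dec-true (i ≟ i) ≡.refl = ≡.refl

  transpose-matchʳ : PC.transpose i j j ≡ i
  transpose-matchʳ with j ≟ i
  ... | yes j≡i = j≡i
  ... | no _ rewrite dec-true (j ≟ j) ≡.refl = ≡.refl

  transpose-other : ∀ {k} → k ≢ i → k ≢ j → PC.transpose i j k ≡ k
  transpose-other {k} k≢i k≢j rewrite dec-false (k ≟ i) k≢i | dec-false (k ≟ j) k≢j = ≡.refl

  transpose-cases : ∀ k → (k ≡ i × PC.transpose i j k ≡ j) ⊎ (k ≡ j × PC.transpose i j k ≡ i) ⊎ PC.transpose i j k ≡ k
  transpose-cases k = by-cases (k ≟ i) (k ≟ j)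
    where
    by-cases : Dec (k ≡ i) → Dec (k ≡ j) →
               (k ≡ i × PC.transpose i j k ≡ j) ⊎ (k ≡ j × PC.transpose i j k ≡ i) ⊎ PC.transpose i j k ≡ k
    by-cases (yes k≡i) _         = inj₁ (k≡i , ≡.trans (≡.cong (PC.transpose i j) k≡i) transpose-matchˡ)
    by-cases (no _)    (yes k≡j) = inj₂ (inj₁ (k≡j , ≡.trans (≡.cong (PC.transpose i j) k≡j) transpose-matchʳ))
    by-cases (no k≢i)  (no k≢j)  = inj₂ (inj₂ (transpose-other k≢i k≢j))

  transpose-involutive : ∀ k → PC.transpose i j (PC.transpose i j k) ≡ k
  transpose-involutive k with transpose-cases k
  ... | inj₁ (≡.refl , τk≡j)        = ≡.trans (≡.cong (PC.transpose i j) τk≡j) transpose-matchʳ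
  ... | inj₂ (inj₁ (≡.refl , τk≡i)) = ≡.trans (≡.cong (PC.transpose i j) τk≡i) transpose-matchˡ
  ... | inj₂ (inj₂ τk≡k)            = ≡.trans (≡.cong (PC.transpose i j) τk≡k) τk≡k

  transpose-injective : Inj (PC.transpose i j)
  transpose-injective {a} {b} eq =
    ≡.trans (≡.sym (transpose-involutive a)) (≡.trans (≡.cong (PC.transpose i j) eq) (transpose-involutive b))

transpose-conjugate : ∀ {M} {p q : Fin (suc (suc M))} → p ≢ q →
                      ∃ λ ρ → Inj ρ × (ρ ∘ PC.transpose zero (suc zero) ≗ PC.transpose p q ∘ ρ)
transpose-conjugate {M} {p} {q} p≢q = ρ , ρ-inj , conj
  where
  r = PC.transpose zero p q
  ρ = PC.transpose zero p ∘ PC.transpose (suc zero) r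
  ρ-inj : Inj ρ
  ρ-inj = transpose-injective (suc zero) r ∘ transpose-injective zero p
  0≢r : zero ≢ r
  0≢r 0≡r = p≢q (≡.trans (≡.sym (transpose-matchˡ zero p))
                         (≡.trans (≡.cong (PC.transpose zero p) 0≡r) (transpose-involutive zero p q)))
  ρ0 : ρ zero ≡ p
  ρ0 = ≡.trans (≡.cong (PC.transpose zero p) (transpose-other (suc zero) r (λ ()) 0≢r)) (transpose-matchˡ zero p)
  ρ1 : ρ (suc zero) ≡ q
  ρ1 = ≡.trans (≡.cong (PC.transpose zero p) (transpose-matchˡ (suc zero) r)) (transpose-involutive zero p q)
  conj : ρ ∘ PC.transpose zero (suc zero) ≗ PC.transpose p q ∘ ρ
  conj zero          = ≡.trans ρ1 (≡.sym (≡.trans (≡.cong (PC.transpose p q) ρ0) (transpose-matchˡ p q)))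
  conj (suc zero)    = ≡.trans ρ0 (≡.sym (≡.trans (≡.cong (PC.transpose p q) ρ1) (transpose-matchʳ p q)))
  conj (suc (suc k)) = ≡.sym (transpose-other p q (λ eq → 2+k≢0 (ρ-inj (≡.trans eq (≡.sym ρ0))))
                                                  (λ eq → 2+k≢1 (ρ-inj (≡.trans eq (≡.sym ρ1)))))
    where
    2+k≢0 : suc (suc k) ≢ zero
    2+k≢0 ()
    2+k≢1 : suc (suc k) ≢ suc zero
    2+k≢1 ()

flips : ∀ {N} → (Fin N → Fin N) → Fin N → Fin N → Bool
flips σ i j = (toℕ i <ᵇ toℕ j) xor (toℕ (σ i) <ᵇ toℕ (σ j))

flips-sym : ∀ {N} {σ : Fin N → Fin N} → Inj σ → ∀ i j → flips σ i j ≡ flips σ j i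
flips-sym {σ = σ} σ-inj i j with i ≟ j
... | yes ≡.refl = ≡.refl
... | no i≢j rewrite <ᵇ-flip (toℕ i) (toℕ j) (i≢j ∘ toℕ-injective)
                   | <ᵇ-flip (toℕ (σ i)) (toℕ (σ j)) (i≢j ∘ σ-inj ∘ toℕ-injective) =
  ≡.sym (xor-annihilates-not (toℕ i <ᵇ toℕ j) _)

flips-∘ : ∀ {N} (σ π : Fin N → Fin N) i j → flips (σ ∘ π) i j ≡ flips π i j xor flips σ (π i) (π j)
flips-∘ σ π i j = ≡.sym (begin
  (x xor y) xor (y xor z)  ≡⟨ xor-assoc x y (y xor z) ⟩
  x xor (y xor (y xor z))  ≡⟨ ≡.cong (x xor_) (≡.sym (xor-assoc y y z)) ⟩
  x xor ((y xor y) xor z)  ≡⟨ ≡.cong (λ w → x xor (w xor z)) (xor-same y) ⟩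
  x xor z                  ∎)
  where
  open ≡.≡-Reasoning
  x = toℕ i <ᵇ toℕ j
  y = toℕ (π i) <ᵇ toℕ (π j)
  z = toℕ (σ (π i)) <ᵇ toℕ (σ (π j))

-- Sums over lists, over Fin n and over all maps Fin n → Fin m

module Summation {c ℓ} (M : CommutativeMonoid c ℓ) where

  open CommutativeMonoid M renaming (Carrier to C)
  open import Algebra.Properties.CommutativeMonoid.Sum M public
  open import Relation.Binary.Reasoning.Setoid setoid

  ∑ₗ : ∀ {a} {A : Set a} → List A → (A → C) → C
  ∑ₗ xs f = foldr _∙_ ε (map f xs)

  module _ {a} {A : Set a} where

    ∑ₗ-cong : ∀ (xs : List A) {f g} → (∀ x → f x ≈ g x) → ∑ₗ xs f ≈ ∑ₗ xs g
    ∑ₗ-cong []       f≈g = refl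
    ∑ₗ-cong (x ∷ xs) f≈g = ∙-cong (f≈g x) (∑ₗ-cong xs f≈g)

    ∑ₗ-++ : ∀ (xs ys : List A) f → ∑ₗ (xs ++ ys) f ≈ ∑ₗ xs f ∙ ∑ₗ ys f
    ∑ₗ-++ []       ys f = sym (identityˡ _)
    ∑ₗ-++ (x ∷ xs) ys f = trans (∙-congˡ (∑ₗ-++ xs ys f)) (sym (assoc _ _ _))

    ∑ₗ-filterᵇ : ∀ (p : A → Bool) xs f → ∑ₗ (filterᵇ p xs) f ≈ ∑ₗ xs (λ x → if p x then f x else ε)
    ∑ₗ-filterᵇ p []       f = refl
    ∑ₗ-filterᵇ p (x ∷ xs) f with p x
    ... | true  = ∙-congˡ (∑ₗ-filterᵇ p xs f)
    ... | false = trans (∑ₗ-filterᵇ p xs f) (sym (identityˡ _))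

  module _ {a b} {A : Set a} {B : Set b} where

    ∑ₗ-map : ∀ (g : A → B) xs f → ∑ₗ (map g xs) f ≡ ∑ₗ xs (f ∘ g)
    ∑ₗ-map g xs f = ≡.cong (foldr _∙_ ε) (≡.sym (map-∘ xs))

    ∑ₗ-concatMap : ∀ (g : A → List B) xs f → ∑ₗ (concatMap g xs) f ≈ ∑ₗ xs (λ x → ∑ₗ (g x) f)
    ∑ₗ-concatMap g []       f = refl
    ∑ₗ-concatMap g (x ∷ xs) f = trans (∑ₗ-++ (g x) _ f) (∙-congˡ (∑ₗ-concatMap g xs f))

  ∑ₗ-allFin : ∀ n (f : Fin n → C) → ∑ₗ (allFin n) f ≡ sum f
  ∑ₗ-allFin n f = ≡.trans (≡.cong (foldr _∙_ ε) (map-tabulate id f)) (foldr-tabulate n f)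
    where
    foldr-tabulate : ∀ n (f : Fin n → C) → foldr _∙_ ε (tabulate f) ≡ sum f
    foldr-tabulate zero    f = ≡.refl
    foldr-tabulate (suc n) f = ≡.cong (f zero ∙_) (foldr-tabulate n (f ∘ suc))

  ∑-cong : ∀ {n} {f g : Fin n → C} → (∀ i → f i ≈ g i) → ∑[ i < n ] f i ≈ ∑[ i < n ] g i
  ∑-cong = sum-cong-≋

  ∑-zero : ∀ {n} {f : Fin n → C} → (∀ i → f i ≈ ε) → sum f ≈ ε
  ∑-zero {n} f≈ε = trans (∑-cong f≈ε) (sum-replicate-zero n)

  ∑-select : ∀ {n} (i : Fin n) (f : Fin n → C) → ∑[ j < n ] (if does (i ≟ j) then f j else ε) ≈ f i
  ∑-select {suc n} zero    f = trans (∙-congˡ (sum-replicate-zero n)) (identityʳ _)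
  ∑-select         (suc i) f = trans (identityˡ _) (∑-select i (f ∘ suc))

  ∑-↑ : ∀ p {q} (f : Fin (p ℕ.+ q) → C) → sum f ≈ sum (f ∘ (_↑ˡ q)) ∙ sum (f ∘ (p ↑ʳ_))
  ∑-↑ zero    f = sym (identityˡ _)
  ∑-↑ (suc p) f = trans (∙-congˡ (∑-↑ p (f ∘ suc))) (sym (assoc _ _ _))

  ∑-combine : ∀ m {k} (f : Fin (m ℕ.* k) → C) → sum f ≈ ∑[ x < m ] ∑[ y < k ] f (combine x y)
  ∑-combine zero        f = refl
  ∑-combine (suc m) {k} f = trans (∑-↑ k f) (∙-congˡ (∑-combine m (f ∘ (k ↑ʳ_))))

  ∑ᶠ : ∀ {m n} → ((Fin n → Fin m) → C) → C
  ∑ᶠ {n = zero}  F = F (λ ())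
  ∑ᶠ {m} {suc n} F = ∑[ x < m ] ∑ᶠ (λ g → F (x ∷ᵥ g))

  ∑ᶠ-cong : ∀ {m n} {F G : (Fin n → Fin m) → C} → (∀ f → F f ≈ G f) → ∑ᶠ F ≈ ∑ᶠ G
  ∑ᶠ-cong {n = zero}  F≈G = F≈G (λ ())
  ∑ᶠ-cong {n = suc n} F≈G = ∑-cong (λ x → ∑ᶠ-cong (λ g → F≈G (x ∷ᵥ g)))

  ∑ᶠ-zero : ∀ {m n} {F : (Fin n → Fin m) → C} → (∀ f → F f ≈ ε) → ∑ᶠ F ≈ ε
  ∑ᶠ-zero {n = zero}  F≈ε = F≈ε (λ ())
  ∑ᶠ-zero {n = suc n} F≈ε = ∑-zero (λ x → ∑ᶠ-zero (λ g → F≈ε (x ∷ᵥ g)))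

  ∑ᶠ-distrib : ∀ {m n} (F G : (Fin n → Fin m) → C) → ∑ᶠ (λ f → F f ∙ G f) ≈ ∑ᶠ F ∙ ∑ᶠ G
  ∑ᶠ-distrib {n = zero}  F G = refl
  ∑ᶠ-distrib {m} {suc n} F G =
    trans (∑-cong {m} λ x → ∑ᶠ-distrib (λ g → F (x ∷ᵥ g)) (λ g → G (x ∷ᵥ g))) (∑-distrib-+ {m} _ _)

  ∑-∑ᶠ-comm : ∀ {k m n} (H : Fin k → (Fin n → Fin m) → C) → ∑[ x < k ] ∑ᶠ (H x) ≈ ∑ᶠ (λ f → ∑[ x < k ] H x f)
  ∑-∑ᶠ-comm {n = zero}        H = refl
  ∑-∑ᶠ-comm {k} {m} {suc n} H = trans (∑-comm {k} {m} _) (∑-cong {m} λ y → ∑-∑ᶠ-comm (λ x g → H x (y ∷ᵥ g)))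

  ∑ᶠ-comm : ∀ {m n m′ n′} (H : (Fin n → Fin m) → (Fin n′ → Fin m′) → C) →
            ∑ᶠ (λ f → ∑ᶠ (H f)) ≈ ∑ᶠ (λ g → ∑ᶠ (λ f → H f g))
  ∑ᶠ-comm {n = zero}    H = refl
  ∑ᶠ-comm {m} {suc n} H =
    trans (∑-cong {m} λ x → ∑ᶠ-comm (λ f → H (x ∷ᵥ f))) (∑-∑ᶠ-comm (λ x g → ∑ᶠ (λ f → H (x ∷ᵥ f) g)))

  ∑ᶠ-finToFun : ∀ {m n} (F : (Fin n → Fin m) → C) → F Preserves _≗_ ⟶ _≈_ →
                ∑ᶠ F ≈ ∑[ i < m ^ n ] F (finToFun i)
  ∑ᶠ-finToFun {n = zero}  F F-cong = trans (F-cong (λ ())) (sym (identityʳ _))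
  ∑ᶠ-finToFun {m} {suc n} F F-cong = begin
    ∑[ x < m ] ∑ᶠ (λ g → F (x ∷ᵥ g))
      ≈⟨ ∑-cong {m} (λ x → ∑ᶠ-finToFun (λ g → F (x ∷ᵥ g)) (F-cong ∘ ∷-cong ≡.refl)) ⟩
    ∑[ x < m ] ∑[ i < m ^ n ] F (x ∷ᵥ finToFun i)
      ≈⟨ ∑-cong (λ x → ∑-cong λ i → F-cong (finToFun-combine x i)) ⟨
    ∑[ x < m ] ∑[ i < m ^ n ] F (finToFun (combine x i))
      ≈⟨ ∑-combine m _ ⟨
    ∑[ j < m ^ suc n ] F (finToFun j)
      ∎

  ∑ᶠ-permute : ∀ {m n} (F : (Fin n → Fin m) → C) → F Preserves _≗_ ⟶ _≈_ → (ρ : Permutation n n) →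
               ∑ᶠ (λ f → F (f ∘ (ρ ⟨$⟩ʳ_))) ≈ ∑ᶠ F
  ∑ᶠ-permute {m} {n} F F-cong ρ = begin
    ∑ᶠ (λ f → F (f ∘ (ρ ⟨$⟩ʳ_)))
      ≈⟨ ∑ᶠ-finToFun _ (λ eq → F-cong (eq ∘ (ρ ⟨$⟩ʳ_))) ⟩
    ∑[ i < m ^ n ] F (finToFun i ∘ (ρ ⟨$⟩ʳ_))
      ≈⟨ ∑-permute _ (precompose ρ) ⟩
    ∑[ i < m ^ n ] F (finToFun (precompose ρ ⟨$⟩ʳ i) ∘ (ρ ⟨$⟩ʳ_))
      ≈⟨ ∑-cong (λ i → F-cong λ t →
           ≡.trans (finToFun-precompose ρ i (ρ ⟨$⟩ʳ t)) (≡.cong (finToFun i) (inverseˡ ρ))) ⟩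
    ∑[ i < m ^ n ] F (finToFun i)
      ≈⟨ ∑ᶠ-finToFun F F-cong ⟨
    ∑ᶠ F
      ∎

  ∑ᶠ-++ : ∀ {m} p {q} (F : (Fin (p ℕ.+ q) → Fin m) → C) → F Preserves _≗_ ⟶ _≈_ →
          ∑ᶠ F ≈ ∑ᶠ {m} {p} (λ g → ∑ᶠ {m} {q} (λ h → F (g ++ᵥ h)))
  ∑ᶠ-++         zero          F F-cong = refl
  ∑ᶠ-++ {m} (suc p) {q} F F-cong = ∑-cong {m} λ x → begin
    ∑ᶠ (λ f → F (x ∷ᵥ f))
      ≈⟨ ∑ᶠ-++ p (λ f → F (x ∷ᵥ f)) (F-cong ∘ ∷-cong ≡.refl) ⟩
    ∑ᶠ {m} {p} (λ g → ∑ᶠ {m} {q} (λ h → F (x ∷ᵥ (g ++ᵥ h))))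
      ≈⟨ ∑ᶠ-cong {m} {p} (λ g → ∑ᶠ-cong {m} {q} λ h → F-cong (∷-++ x g h)) ⟨
    ∑ᶠ {m} {p} (λ g → ∑ᶠ {m} {q} (λ h → F ((x ∷ᵥ g) ++ᵥ h)))
      ∎

  -- the summands vanish on maps with a value in Z, and e enumerates the points outside Z
  ∑ᶠ-restrict : ∀ {c k n} (e : Fin k → Fin c) (Z : Fin c → Set) →
                (∀ {H} → (∀ x → Z x → H x ≈ ε) → sum H ≈ sum (H ∘ e)) →
                ∀ {G : (Fin n → Fin c) → C} → G Preserves _≗_ ⟶ _≈_ → (∀ g i → Z (g i) → G g ≈ ε) →
                ∑ᶠ G ≈ ∑ᶠ (λ g → G (e ∘ g))
  ∑ᶠ-restrict {n = zero}      e Z restrict G-cong G≈ε = G-cong (λ ())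
  ∑ᶠ-restrict {c} {k} {suc n} e Z restrict {G} G-cong G≈ε = begin
    ∑[ x < c ] ∑ᶠ (λ g → G (x ∷ᵥ g))
      ≈⟨ restrict {λ x → ∑ᶠ (λ g → G (x ∷ᵥ g))} (λ x Zx → ∑ᶠ-zero λ g → G≈ε (x ∷ᵥ g) zero Zx) ⟩
    ∑[ i < k ] ∑ᶠ (λ g → G (e i ∷ᵥ g))
      ≈⟨ ∑-cong (λ i → ∑ᶠ-restrict e Z restrict {λ g → G (e i ∷ᵥ g)}
                                 (G-cong ∘ ∷-cong ≡.refl) (λ g j → G≈ε (e i ∷ᵥ g) (suc j))) ⟩
    ∑[ i < k ] ∑ᶠ (λ g → G (e i ∷ᵥ (e ∘ g)))
      ≈⟨ ∑-cong (λ i → ∑ᶠ-cong λ g → G-cong (∘-∷ e i g)) ⟨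
    ∑[ i < k ] ∑ᶠ (λ g → G (e ∘ (i ∷ᵥ g)))
      ∎

  module _ {a} {A : Set a} where

    ∑ₗ-allFunsL-∷ : ∀ d (xs : List A) {F} → F Preserves _≗_ ⟶ _≈_ →
                    ∑ₗ (allFunsL (suc d) xs) F ≈ ∑ₗ xs (λ x → ∑ₗ (allFunsL d xs) (λ f → F (x ∷ᵥ f)))
    ∑ₗ-allFunsL-∷ d xs {F} F-cong = trans (∑ₗ-concatMap _ xs F) (∑ₗ-cong xs λ x →
      trans (reflexive (∑ₗ-map _ (allFunsL d xs) F)) (∑ₗ-cong (allFunsL d xs) λ f →
        F-cong λ { zero → ≡.refl ; (suc k) → ≡.refl }))

    ∑ₗ-allFunsL-∷ʳ : ∀ d (xs : List A) {F} → F Preserves _≗_ ⟶ _≈_ →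
                     ∑ₗ (allFunsL (suc d) xs) F ≈ ∑ₗ (allFunsL d xs) (λ ρ → ∑ₗ xs (λ x → F (ρ ∷ʳ x)))
    ∑ₗ-allFunsL-∷ʳ zero xs F-cong = trans (∑ₗ-allFunsL-∷ zero xs F-cong)
      (trans (∑ₗ-cong xs λ x → trans (identityʳ _) (F-cong λ { zero → ≡.refl })) (sym (identityʳ _)))
    ∑ₗ-allFunsL-∷ʳ (suc d) xs {F} F-cong = begin
      ∑ₗ (allFunsL (suc (suc d)) xs) F
        ≈⟨ ∑ₗ-allFunsL-∷ (suc d) xs F-cong ⟩
      ∑ₗ xs (λ y → ∑ₗ (allFunsL (suc d) xs) (λ f → F (y ∷ᵥ f)))
        ≈⟨ ∑ₗ-cong xs (λ y → ∑ₗ-allFunsL-∷ʳ d xs (F-cong ∘ ∷-cong ≡.refl)) ⟩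
      ∑ₗ xs (λ y → ∑ₗ (allFunsL d xs) (λ ρ → ∑ₗ xs (λ x → F ((y ∷ᵥ ρ) ∷ʳ x))))
        ≈⟨ ∑ₗ-allFunsL-∷ d xs (λ ρ≗ρ′ → ∑ₗ-cong xs (λ x → F-cong (∷ʳ-cong x ρ≗ρ′))) ⟨
      ∑ₗ (allFunsL (suc d) xs) (λ ρ → ∑ₗ xs (λ x → F (ρ ∷ʳ x)))
        ∎

  ∑ₗ-allFunsL : ∀ m n {F : (Fin n → Fin m) → C} → F Preserves _≗_ ⟶ _≈_ → ∑ₗ (allFunsL n (allFin m)) F ≈ ∑ᶠ F
  ∑ₗ-allFunsL m zero    F-cong = identityʳ _
  ∑ₗ-allFunsL m (suc n) {F} F-cong = begin
    ∑ₗ (allFunsL (suc n) (allFin m)) F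
      ≈⟨ ∑ₗ-allFunsL-∷ n (allFin m) F-cong ⟩
    ∑ₗ (allFin m) (λ x → ∑ₗ (allFunsL n (allFin m)) (λ g → F (x ∷ᵥ g)))
      ≈⟨ ∑ₗ-cong (allFin m) (λ x → ∑ₗ-allFunsL m n (F-cong ∘ ∷-cong ≡.refl)) ⟩
    ∑ₗ (allFin m) (λ x → ∑ᶠ (λ g → F (x ∷ᵥ g)))
      ≡⟨ ∑ₗ-allFin m _ ⟩
    ∑[ x < m ] ∑ᶠ (λ g → F (x ∷ᵥ g))
      ∎

module Determinants {c ℓ} (R : CommutativeRing c ℓ) where

  open CommutativeRing R renaming (Carrier to C) hiding (zero)
  open import Algebra.Properties.Ring ring using (-1*x≈-x; -‿involutive; -‿distribˡ-*; -‿distribʳ-*)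
  open import Algebra.Properties.Semiring.Sum semiring using (*-distribˡ-sum; *-distribʳ-sum)
  open import Algebra.Properties.CommutativeSemigroup *-commutativeSemigroup using (x∙yz≈y∙xz; x∙yz≈yx∙z; interchange)
  open import Algebra.Solver.CommutativeMonoid *-commutativeMonoid using (solve; _⊜_) renaming (_⊕_ to _∙ₑ_)
  open import Relation.Binary.Reasoning.Setoid setoid

  module Σ = Summation +-commutativeMonoid
  module Π = Summation *-commutativeMonoid
  open Σ using (sum; sum-syntax; ∑-cong; ∑ₗ; ∑ₗ-cong; ∑ᶠ; ∑ᶠ-cong)

  ∏ : ∀ {n} → (Fin n → C) → C
  ∏ = Π.sum

  ∏-syntax : ∀ n → (Fin n → C) → C
  ∏-syntax _ = ∏

  infixl 10 ∏-syntax
  syntax ∏-syntax n (λ i → x) = ∏[ i < n ] x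

  prodFin≡∏ : ∀ n (f : Fin n → C) → prodFin R n f ≡ ∏ f
  prodFin≡∏ zero    f = ≡.refl
  prodFin≡∏ (suc n) f = ≡.cong (f zero *_) (prodFin≡∏ n (f ∘ suc))

  prodFin-cong : ∀ n {f g : Fin n → C} → (∀ i → f i ≈ g i) → prodFin R n f ≈ prodFin R n g
  prodFin-cong n {f} {g} f≈g = trans (reflexive (prodFin≡∏ n f)) (trans (Π.∑-cong {n} f≈g) (reflexive (≡.sym (prodFin≡∏ n g))))

  ∏-zero : ∀ {n} (f : Fin n → C) i → f i ≈ 0# → ∏ f ≈ 0#
  ∏-zero f zero    fi≈0 = trans (*-congʳ fi≈0) (zeroˡ _)
  ∏-zero f (suc i) fi≈0 = trans (*-congˡ (∏-zero (f ∘ suc) i fi≈0)) (zeroʳ _)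

  *-distribˡ-∑ₗ : ∀ {a} {A : Set a} x (xs : List A) f → x * ∑ₗ xs f ≈ ∑ₗ xs (λ y → x * f y)
  *-distribˡ-∑ₗ x []       f = zeroʳ x
  *-distribˡ-∑ₗ x (y ∷ xs) f = trans (distribˡ x _ _) (+-congˡ (*-distribˡ-∑ₗ x xs f))

  *-distribʳ-∑ₗ : ∀ {a} {A : Set a} x (xs : List A) f → ∑ₗ xs f * x ≈ ∑ₗ xs (λ y → f y * x)
  *-distribʳ-∑ₗ x []       f = zeroˡ x
  *-distribʳ-∑ₗ x (y ∷ xs) f = trans (distribʳ x _ _) (+-congˡ (*-distribʳ-∑ₗ x xs f))

  *-distribˡ-∑ᶠ : ∀ {m n} x (F : (Fin n → Fin m) → C) → x * ∑ᶠ F ≈ ∑ᶠ (λ f → x * F f)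
  *-distribˡ-∑ᶠ {n = zero}  x F = refl
  *-distribˡ-∑ᶠ {m} {suc n} x F = trans (*-distribˡ-sum {m} x _) (∑-cong {m} λ y → *-distribˡ-∑ᶠ x (λ g → F (y ∷ᵥ g)))

  *-distribʳ-∑ᶠ : ∀ {m n} x (F : (Fin n → Fin m) → C) → ∑ᶠ F * x ≈ ∑ᶠ (λ f → F f * x)
  *-distribʳ-∑ᶠ x F = trans (*-comm _ x) (trans (*-distribˡ-∑ᶠ x F) (∑ᶠ-cong λ f → *-comm x (F f)))

  ∏-∑ : ∀ {m n} (g : Fin n → Fin m → C) → ∏[ t < n ] ∑[ a < m ] g t a ≈ ∑ᶠ (λ f → ∏[ t < n ] g t (f t))
  ∏-∑ {n = zero}    g = refl
  ∏-∑ {m} {suc n} g = begin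
    ∑[ a < m ] g zero a * ∏[ t < n ] ∑[ a < m ] g (suc t) a
      ≈⟨ *-congˡ (∏-∑ (g ∘ suc)) ⟩
    ∑[ a < m ] g zero a * ∑ᶠ (λ f → ∏[ t < n ] g (suc t) (f t))
      ≈⟨ *-distribʳ-sum {m} _ (g zero) ⟩
    ∑[ a < m ] (g zero a * ∑ᶠ (λ f → ∏[ t < n ] g (suc t) (f t)))
      ≈⟨ ∑-cong {m} (λ a → *-distribˡ-∑ᶠ (g zero a) (λ f → ∏[ t < n ] g (suc t) (f t))) ⟩
    ∑[ a < m ] ∑ᶠ (λ f → g zero a * ∏[ t < n ] g (suc t) (f t))
      ∎

  pow-cong : ∀ {x y} k → x ≈ y → pow R x k ≈ pow R y k
  pow-cong zero    x≈y = refl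
  pow-cong (suc k) x≈y = *-cong x≈y (pow-cong k x≈y)

  δ-suc : ∀ {n} (x y : Fin n) → δ R (suc x) (suc y) ≡ δ R x y
  δ-suc x y = ≡.cong (if_then 1# else 0#) (⌊⌋-map′ _ _ (x ≟ y))

  ∑-δ : ∀ {n} (x : Fin n) (h : Fin n → C) → ∑[ y < n ] (δ R x y * h y) ≈ h x
  ∑-δ {n} x h = trans (∑-cong {n} δ-*) (Σ.∑-select x h)
    where
    δ-* : ∀ y → δ R x y * h y ≈ (if does (x ≟ y) then h y else 0#)
    δ-* y with x ≟ y
    ... | yes _ = *-identityˡ _
    ... | no _  = zeroˡ _

  -- The sign of a map

  negPow² : ∀ k → negPow R k * negPow R k ≈ 1#
  negPow² zero    = *-identityˡ 1#
  negPow² (suc k) = begin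
    - negPow R k * - negPow R k     ≈⟨ -‿distribˡ-* _ _ ⟨
    - (negPow R k * - negPow R k)   ≈⟨ -‿cong (-‿distribʳ-* _ _) ⟨
    - - (negPow R k * negPow R k)   ≈⟨ -‿involutive _ ⟩
    negPow R k * negPow R k         ≈⟨ negPow² k ⟩
    1#                              ∎

  sgnᵇ : Bool → C
  sgnᵇ b = if b then - 1# else 1#

  sgnᵇ-xor : ∀ a b → sgnᵇ (a xor b) ≈ sgnᵇ a * sgnᵇ b
  sgnᵇ-xor false b     = sym (*-identityˡ _)
  sgnᵇ-xor true  false = sym (*-identityʳ _)
  sgnᵇ-xor true  true  = sym (trans (-1*x≈-x _) (-‿involutive _))

  sgnᵇ-∧ : ∀ a b → sgnᵇ (a ∧ b) ≡ (if a then sgnᵇ b else 1#)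
  sgnᵇ-∧ false b = ≡.refl
  sgnᵇ-∧ true  b = ≡.refl

  negPow-length-filterᵇ : ∀ {a} {A : Set a} (p : A → Bool) xs → negPow R (length (filterᵇ p xs)) ≈ Π.∑ₗ xs (sgnᵇ ∘ p)
  negPow-length-filterᵇ p []       = refl
  negPow-length-filterᵇ p (x ∷ xs) with p x
  ... | true  = trans (-‿cong (negPow-length-filterᵇ p xs)) (sym (-1*x≈-x _))
  ... | false = trans (negPow-length-filterᵇ p xs) (sym (*-identityˡ _))

  module _ {N : ℕ} where

    ∏∏ : (Fin N → Fin N → C) → C
    ∏∏ F = ∏[ i < N ] ∏[ j < N ] F i j

    ∏< : (Fin N → Fin N → C) → C
    ∏< F = ∏∏ (λ i j → if toℕ i <ᵇ toℕ j then F i j else 1#)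

    sgn≈∏< : ∀ (σ : Fin N → Fin N) → sgn R σ ≈ ∏< (λ i j → sgnᵇ (toℕ (σ j) <ᵇ toℕ (σ i)))
    sgn≈∏< σ = begin
      negPow R (length (filterᵇ inverted pairs))
        ≈⟨ negPow-length-filterᵇ inverted pairs ⟩
      Π.∑ₗ pairs (sgnᵇ ∘ inverted)
        ≈⟨ Π.∑ₗ-concatMap _ (allFin N) _ ⟩
      Π.∑ₗ (allFin N) (λ i → Π.∑ₗ (map (i ,_) (allFin N)) (sgnᵇ ∘ inverted))
        ≈⟨ Π.∑ₗ-cong (allFin N) (λ i → reflexive (≡.trans (Π.∑ₗ-map _ (allFin N) _) (Π.∑ₗ-allFin N _))) ⟩
      Π.∑ₗ (allFin N) (λ i → ∏[ j < N ] sgnᵇ (inverted (i , j)))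
        ≡⟨ Π.∑ₗ-allFin N _ ⟩
      ∏[ i < N ] ∏[ j < N ] sgnᵇ (inverted (i , j))
        ≈⟨ Π.∑-cong {N} (λ i → Π.∑-cong {N} λ j → reflexive (sgnᵇ-∧ (toℕ i <ᵇ toℕ j) _)) ⟩
      ∏< (λ i j → sgnᵇ (toℕ (σ j) <ᵇ toℕ (σ i)))
        ∎
      where
      pairs = concatMap (λ i → map (λ j → i , j) (allFin N)) (allFin N)
      inverted : Fin N × Fin N → Bool
      inverted p = (toℕ (proj₁ p) <ᵇ toℕ (proj₂ p)) ∧ (toℕ (σ (proj₂ p)) <ᵇ toℕ (σ (proj₁ p)))

    ∏∏-cong : ∀ {F G : Fin N → Fin N → C} → (∀ i j → F i j ≈ G i j) → ∏∏ F ≈ ∏∏ G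
    ∏∏-cong F≈G = Π.∑-cong {N} λ i → Π.∑-cong {N} (F≈G i)

    ∏∏-* : ∀ (F G : Fin N → Fin N → C) → ∏∏ (λ i j → F i j * G i j) ≈ ∏∏ F * ∏∏ G
    ∏∏-* F G = trans (Π.∑-cong {N} λ i → Π.∑-distrib-+ {N} (F i) (G i)) (Π.∑-distrib-+ {N} _ _)

    ∏<-cong : ∀ {F G : Fin N → Fin N → C} → (∀ i j → (toℕ i <ᵇ toℕ j) ≡ true → F i j ≈ G i j) → ∏< F ≈ ∏< G
    ∏<-cong {F} {G} F≈G = ∏∏-cong guarded
      where
      guarded : ∀ i j → (if toℕ i <ᵇ toℕ j then F i j else 1#) ≈ (if toℕ i <ᵇ toℕ j then G i j else 1#)
      guarded i j with toℕ i <ᵇ toℕ j in i<j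
      ... | true  = F≈G i j i<j
      ... | false = refl

    ∏<-* : ∀ (F G : Fin N → Fin N → C) → ∏< (λ i j → F i j * G i j) ≈ ∏< F * ∏< G
    ∏<-* F G = trans (∏∏-cong split) (∏∏-* _ _)
      where
      split : ∀ i j → (if toℕ i <ᵇ toℕ j then F i j * G i j else 1#)
                    ≈ (if toℕ i <ᵇ toℕ j then F i j else 1#) * (if toℕ i <ᵇ toℕ j then G i j else 1#)
      split i j with toℕ i <ᵇ toℕ j
      ... | true  = refl
      ... | false = sym (*-identityˡ 1#)

    ∏∏-halves : ∀ (G : Fin N → Fin N → C) → ∏∏ G ≈ ∏< (λ a b → G a b * G b a) * ∏[ a < N ] G a a
    ∏∏-halves G = begin
      ∏∏ G
        ≈⟨ ∏∏-cong trichotomy ⟩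
      ∏∏ (λ a b → below a b * (above a b * diagonal a b))
        ≈⟨ trans (∏∏-* _ _) (*-congˡ (∏∏-* _ _)) ⟩
      ∏< G * (∏∏ above * ∏∏ diagonal)
        ≈⟨ *-congˡ (*-cong (Π.∑-comm {N} {N} above) (Π.∑-cong {N} λ a → Π.∑-select a (G a))) ⟩
      ∏< G * (∏< (λ a b → G b a) * ∏[ a < N ] G a a)
        ≈⟨ *-assoc _ _ _ ⟨
      ∏< G * ∏< (λ a b → G b a) * ∏[ a < N ] G a a
        ≈⟨ *-congʳ (∏<-* _ _) ⟨
      ∏< (λ a b → G a b * G b a) * ∏[ a < N ] G a a
        ∎
      where
      below above diagonal : Fin N → Fin N → C
      below    a b = if toℕ a <ᵇ toℕ b then G a b else 1#
      above    a b = if toℕ b <ᵇ toℕ a then G a b else 1#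
      diagonal a b = if does (a ≟ b) then G a b else 1#
      trichotomy : ∀ a b → G a b ≈ below a b * (above a b * diagonal a b)
      trichotomy a b with a ≟ b
      ... | yes ≡.refl rewrite <ᵇ-irrefl (toℕ a) = sym (trans (*-identityˡ _) (*-identityˡ _))
      ... | no a≢b rewrite <ᵇ-flip (toℕ a) (toℕ b) (a≢b ∘ toℕ-injective) with toℕ a <ᵇ toℕ b
      ...   | true  = sym (trans (*-congˡ (*-identityˡ 1#)) (*-identityʳ _))
      ...   | false = sym (trans (*-identityˡ _) (*-identityʳ _))

    <ᵇ⇒≢ : ∀ {a b : Fin N} → (toℕ a <ᵇ toℕ b) ≡ true → a ≢ b
    <ᵇ⇒≢ {a} a<b ≡.refl with () ← ≡.trans (≡.sym (<ᵇ-irrefl (toℕ a))) a<b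

    ∏∏-relabel : ∀ {τ : Fin N → Fin N} → Inj τ → (F : Fin N → Fin N → C) → (∀ a b → F a b ≈ F b a) →
                 ∏∏ (λ a b → if toℕ (τ a) <ᵇ toℕ (τ b) then F a b else 1#) ≈ ∏< F
    ∏∏-relabel {τ} τ-inj F F-sym = begin
      ∏∏ G                                            ≈⟨ ∏∏-halves G ⟩
      ∏< (λ a b → G a b * G b a) * ∏[ a < N ] G a a   ≈⟨ *-cong (∏<-cong pair) (Π.∑-zero diagonal) ⟩
      ∏< F * 1#                                       ≈⟨ *-identityʳ _ ⟩
      ∏< F                                            ∎
      where
      G : Fin N → Fin N → C
      G a b = if toℕ (τ a) <ᵇ toℕ (τ b) then F a b else 1#
      pair : ∀ a b → (toℕ a <ᵇ toℕ b) ≡ true → G a b * G b a ≈ F a b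
      pair a b a<b rewrite <ᵇ-flip (toℕ (τ a)) (toℕ (τ b)) (<ᵇ⇒≢ a<b ∘ τ-inj ∘ toℕ-injective)
        with toℕ (τ a) <ᵇ toℕ (τ b)
      ... | true  = *-identityʳ _
      ... | false = trans (*-identityˡ _) (F-sym b a)
      diagonal : ∀ a → G a a ≈ 1#
      diagonal a rewrite <ᵇ-irrefl (toℕ (τ a)) = refl

    ∏<-permute : ∀ {π : Fin N → Fin N} → Inj π → (F : Fin N → Fin N → C) → (∀ a b → F a b ≈ F b a) →
                 ∏< (λ i j → F (π i) (π j)) ≈ ∏< F
    ∏<-permute {π} π-inj F F-sym = begin
      ∏< (λ i j → F (π i) (π j))
        ≈⟨ Π.∑-permute {N} _ (Perm.flip P) ⟩
      ∏[ a < N ] ∏[ j < N ] (if toℕ (π⁻¹ a) <ᵇ toℕ j then F (π (π⁻¹ a)) (π j) else 1#)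
        ≈⟨ Π.∑-cong {N} (λ a → Π.∑-permute {N} _ (Perm.flip P)) ⟩
      ∏∏ (λ a b → if toℕ (π⁻¹ a) <ᵇ toℕ (π⁻¹ b) then F (π (π⁻¹ a)) (π (π⁻¹ b)) else 1#)
        ≈⟨ ∏∏-cong (λ a b → reflexive (≡.cong₂ (λ x y → if toℕ (π⁻¹ a) <ᵇ toℕ (π⁻¹ b) then F x y else 1#)
                                               (inverseʳ P) (inverseʳ P))) ⟩
      ∏∏ (λ a b → if toℕ (π⁻¹ a) <ᵇ toℕ (π⁻¹ b) then F a b else 1#)
        ≈⟨ ∏∏-relabel π⁻¹-inj F F-sym ⟩
      ∏< F
        ∎
      where
      P = injective⇒permutation π-inj
      π⁻¹ = P ⟨$⟩ˡ_
      π⁻¹-inj : Inj π⁻¹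
      π⁻¹-inj eq = ≡.trans (≡.sym (inverseʳ P)) (≡.trans (≡.cong π eq) (inverseʳ P))

    sgn≈∏<flips : ∀ {σ : Fin N → Fin N} → Inj σ → sgn R σ ≈ ∏< (λ i j → sgnᵇ (flips σ i j))
    sgn≈∏<flips {σ} σ-inj = trans (sgn≈∏< σ) (∏<-cong λ i j i<j → reflexive (≡.cong sgnᵇ
      (≡.trans (<ᵇ-flip _ _ (<ᵇ⇒≢ i<j ∘ σ-inj ∘ toℕ-injective))
               (≡.cong (_xor (toℕ (σ i) <ᵇ toℕ (σ j))) (≡.sym i<j)))))

    sgn-∘ : ∀ {σ π : Fin N → Fin N} → Inj σ → Inj π → sgn R (σ ∘ π) ≈ sgn R σ * sgn R π
    sgn-∘ {σ} {π} σ-inj π-inj = begin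
      sgn R (σ ∘ π)
        ≈⟨ sgn≈∏<flips (π-inj ∘ σ-inj) ⟩
      ∏< (λ i j → sgnᵇ (flips (σ ∘ π) i j))
        ≈⟨ ∏<-cong (λ i j _ → trans (reflexive (≡.cong sgnᵇ (flips-∘ σ π i j))) (sgnᵇ-xor _ _)) ⟩
      ∏< (λ i j → sgnᵇ (flips π i j) * sgnᵇ (flips σ (π i) (π j)))
        ≈⟨ ∏<-* _ _ ⟩
      ∏< (λ i j → sgnᵇ (flips π i j)) * ∏< (λ i j → sgnᵇ (flips σ (π i) (π j)))
        ≈⟨ *-congˡ (∏<-permute π-inj _ λ a b → reflexive (≡.cong sgnᵇ (flips-sym σ-inj a b))) ⟩
      ∏< (λ i j → sgnᵇ (flips π i j)) * ∏< (λ i j → sgnᵇ (flips σ i j))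
        ≈⟨ *-cong (sgn≈∏<flips π-inj) (sgn≈∏<flips σ-inj) ⟨
      sgn R π * sgn R σ
        ≈⟨ *-comm _ _ ⟩
      sgn R σ * sgn R π
        ∎

    sgn-cong : ∀ {σ τ : Fin N → Fin N} → σ ≗ τ → sgn R σ ≈ sgn R τ
    sgn-cong {σ} {τ} σ≗τ = begin
      sgn R σ
        ≈⟨ sgn≈∏< σ ⟩
      ∏< (λ i j → sgnᵇ (toℕ (σ j) <ᵇ toℕ (σ i)))
        ≈⟨ ∏∏-cong (λ i j → reflexive (≡.cong₂ (λ x y → if toℕ i <ᵇ toℕ j then sgnᵇ (toℕ y <ᵇ toℕ x) else 1#)
                                               (σ≗τ i) (σ≗τ j))) ⟩
      ∏< (λ i j → sgnᵇ (toℕ (τ j) <ᵇ toℕ (τ i)))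
        ≈⟨ sgn≈∏< τ ⟨
      sgn R τ
        ∎

  sgn-⊕ : ∀ {p q} (g : Fin p → Fin p) (h : Fin q → Fin q) → sgn R (g ⊕ h) ≈ sgn R g * sgn R h
  sgn-⊕ {p} {q} g h = begin
    sgn R (g ⊕ h)
      ≈⟨ sgn≈∏< (g ⊕ h) ⟩
    ∏[ a < p ℕ.+ q ] ∏[ b < p ℕ.+ q ] K (g ⊕ h) a b
      ≈⟨ Π.∑-↑ p _ ⟩
    ∏[ i < p ] ∏[ b < p ℕ.+ q ] K (g ⊕ h) (i ↑ˡ q) b * ∏[ j < q ] ∏[ b < p ℕ.+ q ] K (g ⊕ h) (p ↑ʳ j) b
      ≈⟨ *-cong (Π.∑-cong {p} λ i → trans (Π.∑-↑ p _) (*-cong (Π.∑-cong {p} (LL i)) (Π.∑-zero (LR i))))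
                (Π.∑-cong {q} λ j → trans (Π.∑-↑ p _) (*-cong (Π.∑-zero (RL j)) (Π.∑-cong {q} (RR j)))) ⟩
    ∏[ i < p ] (∏[ i′ < p ] K g i i′ * 1#) * ∏[ j < q ] (1# * ∏[ j′ < q ] K h j j′)
      ≈⟨ *-cong (Π.∑-cong {p} λ i → *-identityʳ _) (Π.∑-cong {q} λ j → *-identityˡ _) ⟩
    ∏< (λ i i′ → sgnᵇ (toℕ (g i′) <ᵇ toℕ (g i))) * ∏< (λ j j′ → sgnᵇ (toℕ (h j′) <ᵇ toℕ (h j)))
      ≈⟨ *-cong (sgn≈∏< g) (sgn≈∏< h) ⟨
    sgn R g * sgn R h
      ∎
    where
    K : ∀ {N} → (Fin N → Fin N) → Fin N → Fin N → C
    K σ a b = if toℕ a <ᵇ toℕ b then sgnᵇ (toℕ (σ b) <ᵇ toℕ (σ a)) else 1#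
    LL : ∀ i i′ → K (g ⊕ h) (i ↑ˡ q) (i′ ↑ˡ q) ≈ K g i i′
    LL i i′ rewrite ⊕-↑ˡ g h i | ⊕-↑ˡ g h i′ | toℕ-↑ˡ i q | toℕ-↑ˡ i′ q | toℕ-↑ˡ (g i) q | toℕ-↑ˡ (g i′) q
      = refl
    LR : ∀ i j → K (g ⊕ h) (i ↑ˡ q) (p ↑ʳ j) ≈ 1#
    LR i j rewrite ⊕-↑ˡ g h i | ⊕-↑ʳ g h j | toℕ-↑ʳ p (h j) | toℕ-↑ˡ (g i) q
                 | +-<ᵇ-false p (toℕ (h j)) (toℕ (g i)) (toℕ<n (g i)) with toℕ (i ↑ˡ q) <ᵇ toℕ (p ↑ʳ j)
    ... | true  = refl
    ... | false = refl
    RL : ∀ j i → K (g ⊕ h) (p ↑ʳ j) (i ↑ˡ q) ≈ 1#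
    RL j i rewrite toℕ-↑ʳ p j | toℕ-↑ˡ i q | +-<ᵇ-false p (toℕ j) (toℕ i) (toℕ<n i) = refl
    RR : ∀ j j′ → K (g ⊕ h) (p ↑ʳ j) (p ↑ʳ j′) ≈ K h j j′
    RR j j′ rewrite ⊕-↑ʳ g h j | ⊕-↑ʳ g h j′ | toℕ-↑ʳ p j | toℕ-↑ʳ p j′ | toℕ-↑ʳ p (h j) | toℕ-↑ʳ p (h j′)
                  | +-<ᵇ-+ p (toℕ j) (toℕ j′) | +-<ᵇ-+ p (toℕ (h j′)) (toℕ (h j)) = refl

  sgn-swap01 : ∀ {M} → sgn R (PC.transpose {suc (suc M)} zero (suc zero)) ≈ - 1#
  sgn-swap01 {M} = begin
    sgn R s
      ≈⟨ sgn≈∏< s ⟩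
    ∏[ j < 2+M ] L zero j * (∏[ j < 2+M ] L (suc zero) j * ∏[ k < M ] ∏[ j < 2+M ] L (suc (suc k)) j)
      ≈⟨ *-cong row₀ (*-cong row₁ (Π.∑-zero rowₖ)) ⟩
    - 1# * (1# * 1#)
      ≈⟨ trans (*-congˡ (*-identityˡ 1#)) (*-identityʳ _) ⟩
    - 1#
      ∎
    where
    2+M = suc (suc M)
    s = PC.transpose {2+M} zero (suc zero)
    L : Fin 2+M → Fin 2+M → C
    L i j = if toℕ i <ᵇ toℕ j then sgnᵇ (toℕ (s j) <ᵇ toℕ (s i)) else 1#
    row₀ : ∏[ j < 2+M ] L zero j ≈ - 1#
    row₀ = trans (*-identityˡ _) (trans (*-congˡ (Π.sum-replicate-zero M)) (*-identityʳ _))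
    row₁ : ∏[ j < 2+M ] L (suc zero) j ≈ 1#
    row₁ = trans (*-identityˡ _) (trans (*-identityˡ _) (Π.sum-replicate-zero M))
    rowₖ : ∀ k → ∏[ j < 2+M ] L (suc (suc k)) j ≈ 1#
    rowₖ k = trans (*-identityˡ _) (trans (*-identityˡ _) (Π.∑-zero {M} entry))
      where
      entry : ∀ l → (if toℕ k <ᵇ toℕ l then sgnᵇ (toℕ l <ᵇ toℕ k) else 1#) ≈ 1#
      entry l with toℕ k <ᵇ toℕ l in k<l
      ... | true rewrite <ᵇ-asym (toℕ k) (toℕ l) k<l = refl
      ... | false = refl

  ε : ∀ {N} → (Fin N → Fin N) → C
  ε σ = if injᵇ σ then sgn R σ else 0#

  module _ {N : ℕ} where

    ε-injective : ∀ {σ : Fin N → Fin N} → Inj σ → ε σ ≡ sgn R σ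
    ε-injective {σ} σ-inj with injᵇ σ | injᵇ-complete σ-inj
    ... | true | _ = ≡.refl

    ε-nonInjective : ∀ {σ : Fin N → Fin N} → ¬ Inj σ → ε σ ≡ 0#
    ε-nonInjective {σ} ¬σ-inj with injᵇ σ | injᵇ-sound {σ = σ}
    ... | true  | sound = ⊥-elim (¬σ-inj (sound _))
    ... | false | _     = ≡.refl

    ε² : ∀ {σ : Fin N → Fin N} → Inj σ → ε σ * ε σ ≈ 1#
    ε² {σ} σ-inj = trans (reflexive (≡.cong₂ _*_ (ε-injective σ-inj) (ε-injective σ-inj))) (negPow² (inversions σ))

    ε-cong : ∀ {σ τ : Fin N → Fin N} → σ ≗ τ → ε σ ≈ ε τ
    ε-cong {σ} {τ} σ≗τ with injective? σ
    ... | yes σ-inj = begin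
      ε σ      ≡⟨ ε-injective σ-inj ⟩
      sgn R σ  ≈⟨ sgn-cong σ≗τ ⟩
      sgn R τ  ≡⟨ ε-injective (Inj-resp-≗ σ≗τ σ-inj) ⟨
      ε τ      ∎
    ... | no ¬σ-inj =
      reflexive (≡.trans (ε-nonInjective ¬σ-inj) (≡.sym (ε-nonInjective (¬σ-inj ∘ Inj-resp-≗ (≡.sym ∘ σ≗τ)))))

    ε-∘ : ∀ (σ π : Fin N → Fin N) → ε (σ ∘ π) ≈ ε σ * ε π
    ε-∘ σ π with injective? π | injective? σ
    ... | no ¬π-inj | _ = begin
      ε (σ ∘ π)          ≡⟨ ε-nonInjective (¬π-inj ∘ ∘-injectiveʳ {σ = σ}) ⟩
      0#                 ≈⟨ zeroʳ _ ⟨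
      ε σ * 0#           ≡⟨ ≡.cong (ε σ *_) (ε-nonInjective ¬π-inj) ⟨
      ε σ * ε π          ∎
    ... | yes π-inj | yes σ-inj = begin
      ε (σ ∘ π)          ≡⟨ ε-injective (π-inj ∘ σ-inj) ⟩
      sgn R (σ ∘ π)      ≈⟨ sgn-∘ σ-inj π-inj ⟩
      sgn R σ * sgn R π  ≡⟨ ≡.cong₂ _*_ (ε-injective σ-inj) (ε-injective π-inj) ⟨
      ε σ * ε π          ∎
    ... | yes π-inj | no ¬σ-inj = begin
      ε (σ ∘ π)          ≡⟨ ε-nonInjective (¬σ-inj ∘ ∘-injectiveˡ π-inj) ⟩
      0#                 ≈⟨ zeroˡ _ ⟨
      0# * ε π           ≡⟨ ≡.cong (_* ε π) (ε-nonInjective ¬σ-inj) ⟨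
      ε σ * ε π          ∎

  ε-⊕ : ∀ {p q} (g : Fin p → Fin p) (h : Fin q → Fin q) → ε (g ⊕ h) ≈ ε g * ε h
  ε-⊕ g h with injective? g | injective? h
  ... | yes g-inj | yes h-inj = begin
    ε (g ⊕ h)          ≡⟨ ε-injective (⊕-injective g h g-inj h-inj) ⟩
    sgn R (g ⊕ h)      ≈⟨ sgn-⊕ g h ⟩
    sgn R g * sgn R h  ≡⟨ ≡.cong₂ _*_ (ε-injective g-inj) (ε-injective h-inj) ⟨
    ε g * ε h          ∎
  ... | no ¬g-inj | _ = begin
    ε (g ⊕ h)          ≡⟨ ε-nonInjective (¬g-inj ∘ ⊕-injectiveˡ g h) ⟩
    0#                 ≈⟨ zeroˡ _ ⟨
    0# * ε h           ≡⟨ ≡.cong (_* ε h) (ε-nonInjective ¬g-inj) ⟨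
    ε g * ε h          ∎
  ... | yes _ | no ¬h-inj = begin
    ε (g ⊕ h)          ≡⟨ ε-nonInjective (¬h-inj ∘ ⊕-injectiveʳ g h) ⟩
    0#                 ≈⟨ zeroʳ _ ⟨
    ε g * 0#           ≡⟨ ≡.cong (ε g *_) (ε-nonInjective ¬h-inj) ⟨
    ε g * ε h          ∎

  *-cancelʳ-selfInverse : ∀ {x y u} → u * u ≈ 1# → x * u ≈ y * u → x ≈ y
  *-cancelʳ-selfInverse {x} {y} {u} u²≈1 xu≈yu = begin
    x              ≈⟨ trans (*-congˡ u²≈1) (*-identityʳ x) ⟨
    x * (u * u)    ≈⟨ *-assoc x u u ⟨
    x * u * u      ≈⟨ *-congʳ xu≈yu ⟩
    y * u * u      ≈⟨ *-assoc y u u ⟩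
    y * (u * u)    ≈⟨ trans (*-congˡ u²≈1) (*-identityʳ y) ⟩
    y              ∎

  ε-transpose : ∀ {N} {p q : Fin N} → p ≢ q → ε (PC.transpose p q) ≈ - 1#
  ε-transpose {suc zero} {zero} {zero} p≢q = ⊥-elim (p≢q ≡.refl)
  ε-transpose {suc (suc M)} {p} {q} p≢q with transpose-conjugate p≢q
  ... | ρ , ρ-inj , conj = *-cancelʳ-selfInverse (ε² ρ-inj) (begin
    ε τ * ε ρ      ≈⟨ ε-∘ τ ρ ⟨
    ε (τ ∘ ρ)      ≈⟨ ε-cong conj ⟨
    ε (ρ ∘ s)      ≈⟨ ε-∘ ρ s ⟩
    ε ρ * ε s      ≈⟨ *-congˡ (trans (reflexive (ε-injective (transpose-injective {suc (suc M)} zero (suc zero)))) (sgn-swap01 {M})) ⟩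
    ε ρ * - 1#     ≈⟨ *-comm _ _ ⟩
    - 1# * ε ρ     ∎)
    where
    τ = PC.transpose p q
    s = PC.transpose {suc (suc M)} zero (suc zero)

  -- Determinants

  ∑ᶠ-alternating : ∀ {m n} (X : (Fin n → Fin m) → C) → X Preserves _≗_ ⟶ _≈_ → ∀ {p q : Fin n} →
                   (∀ σ → X (σ ∘ PC.transpose p q) ≈ - X σ) → (∀ σ → σ p ≡ σ q → X σ ≈ 0#) → ∑ᶠ X ≈ 0#
  ∑ᶠ-alternating {m} {n} X X-cong {p} {q} X-swap X-diag = begin
    ∑ᶠ X
      ≈⟨ ∑ᶠ-cong split ⟩
    ∑ᶠ (λ σ → [ σ p < σ q ] X σ + [ σ q < σ p ] X σ)
      ≈⟨ Σ.∑ᶠ-distrib {m} {n} _ _ ⟩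
    ∑ᶠ (λ σ → [ σ p < σ q ] X σ) + ∑ᶠ (λ σ → [ σ q < σ p ] X σ)
      ≈⟨ +-congˡ swapped ⟩
    ∑ᶠ (λ σ → [ σ p < σ q ] X σ) + ∑ᶠ (λ σ → [ σ p < σ q ] (- X σ))
      ≈⟨ Σ.∑ᶠ-distrib {m} {n} _ _ ⟨
    ∑ᶠ (λ σ → [ σ p < σ q ] X σ + [ σ p < σ q ] (- X σ))
      ≈⟨ Σ.∑ᶠ-zero {m} {n} (λ σ → cancel (toℕ (σ p) <ᵇ toℕ (σ q)) (X σ)) ⟩
    0#
      ∎
    where
    t = PC.transpose p q
    [_<_]_ : Fin m → Fin m → C → C
    [ x < y ] z = if toℕ x <ᵇ toℕ y then z else 0#
    guarded-cong : ∀ b {x y} → x ≈ y → (if b then x else 0#) ≈ (if b then y else 0#)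
    guarded-cong true  x≈y = x≈y
    guarded-cong false _   = refl
    split : ∀ σ → X σ ≈ [ σ p < σ q ] X σ + [ σ q < σ p ] X σ
    split σ with σ p ≟ σ q
    ... | yes σp≡σq rewrite σp≡σq | <ᵇ-irrefl (toℕ (σ q)) = trans (X-diag σ σp≡σq) (sym (+-identityˡ 0#))
    ... | no σp≢σq rewrite <ᵇ-flip (toℕ (σ p)) (toℕ (σ q)) (σp≢σq ∘ toℕ-injective) with toℕ (σ p) <ᵇ toℕ (σ q)
    ...   | true  = sym (+-identityʳ _)
    ...   | false = sym (+-identityˡ _)
    swapped : ∑ᶠ (λ σ → [ σ q < σ p ] X σ) ≈ ∑ᶠ (λ σ → [ σ p < σ q ] (- X σ))
    swapped = begin
      ∑ᶠ (λ σ → [ σ q < σ p ] X σ)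
        ≈⟨ Σ.∑ᶠ-permute (λ σ → [ σ q < σ p ] X σ) guarded-X-cong (Perm.transpose p q) ⟨
      ∑ᶠ (λ σ → [ σ (t q) < σ (t p) ] X (σ ∘ t))
        ≈⟨ ∑ᶠ-cong (λ σ → reflexive (≡.cong₂ (λ x y → [ σ x < σ y ] X (σ ∘ t))
                                             (transpose-matchʳ p q) (transpose-matchˡ p q))) ⟩
      ∑ᶠ (λ σ → [ σ p < σ q ] X (σ ∘ t))
        ≈⟨ ∑ᶠ-cong (λ σ → guarded-cong (toℕ (σ p) <ᵇ toℕ (σ q)) (X-swap σ)) ⟩
      ∑ᶠ (λ σ → [ σ p < σ q ] (- X σ))
        ∎
      where
      guarded-X-cong : (λ σ → [ σ q < σ p ] X σ) Preserves _≗_ ⟶ _≈_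
      guarded-X-cong {σ} {σ′} σ≗σ′ = trans (reflexive (≡.cong₂ (λ x y → [ x < y ] X σ) (σ≗σ′ q) (σ≗σ′ p)))
                                           (guarded-cong (toℕ (σ′ q) <ᵇ toℕ (σ′ p)) (X-cong σ≗σ′))
    cancel : ∀ b x → (if b then x else 0#) + (if b then - x else 0#) ≈ 0#
    cancel true  x = -‿inverseʳ x
    cancel false x = +-identityˡ 0#

  module _ {N : ℕ} where

    ε∏ : (Fin N → Fin N → C) → (Fin N → Fin N) → C
    ε∏ A σ = ε σ * ∏[ t < N ] A t (σ t)

    ε∏-cong : ∀ A → ε∏ A Preserves _≗_ ⟶ _≈_
    ε∏-cong A σ≗τ = *-cong (ε-cong σ≗τ) (Π.∑-cong {N} λ t → reflexive (≡.cong (A t) (σ≗τ t)))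

    det′ : (Fin N → Fin N → C) → C
    det′ A = ∑ᶠ (ε∏ A)

    det′-cong : ∀ {A B : Fin N → Fin N → C} → (∀ t u → A t u ≈ B t u) → det′ A ≈ det′ B
    det′-cong A≈B = ∑ᶠ-cong λ σ → *-congˡ (Π.∑-cong {N} λ t → A≈B t (σ t))

    det≈det′ : ∀ A → det R N A ≈ det′ A
    det≈det′ A = begin
      ∑ₗ (filterᵇ injᵇ maps) (λ σ → sgn R σ * prodFin R N (λ t → A t (σ t)))
        ≈⟨ Σ.∑ₗ-filterᵇ injᵇ maps _ ⟩
      ∑ₗ maps (λ σ → if injᵇ σ then sgn R σ * prodFin R N (λ t → A t (σ t)) else 0#)
        ≈⟨ ∑ₗ-cong maps term ⟩
      ∑ₗ maps (ε∏ A)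
        ≈⟨ Σ.∑ₗ-allFunsL N N (ε∏-cong A) ⟩
      det′ A
        ∎
      where
      maps = allFunsL N (allFin N)
      term : ∀ σ → (if injᵇ σ then sgn R σ * prodFin R N (λ t → A t (σ t)) else 0#) ≈ ε∏ A σ
      term σ with injᵇ σ
      ... | true  = *-congˡ (reflexive (prodFin≡∏ N _))
      ... | false = sym (zeroˡ _)

    det′-equalRows : ∀ (A : Fin N → Fin N → C) {p q} → p ≢ q → (∀ u → A p u ≈ A q u) → det′ A ≈ 0#
    det′-equalRows A {p} {q} p≢q Ap≈Aq = ∑ᶠ-alternating (ε∏ A) (ε∏-cong A) ε∏-swap ε∏-collision
      where
      t = PC.transpose p q
      rows-swapped : ∀ u w → A (t u) w ≈ A u w
      rows-swapped u w with transpose-cases p q u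
      ... | inj₁ (≡.refl , tu≡q)        = trans (reflexive (≡.cong (λ r → A r w) tu≡q)) (sym (Ap≈Aq w))
      ... | inj₂ (inj₁ (≡.refl , tu≡p)) = trans (reflexive (≡.cong (λ r → A r w) tu≡p)) (Ap≈Aq w)
      ... | inj₂ (inj₂ tu≡u)            = reflexive (≡.cong (λ r → A r w) tu≡u)
      ε∏-swap : ∀ σ → ε∏ A (σ ∘ t) ≈ - ε∏ A σ
      ε∏-swap σ = begin
        ε (σ ∘ t) * ∏[ u < N ] A u (σ (t u))
          ≈⟨ *-cong (sym (ε-∘ σ t)) (Π.∑-cong {N} λ u → rows-swapped u (σ (t u))) ⟨
        ε σ * ε t * ∏[ u < N ] A (t u) (σ (t u))
          ≈⟨ *-cong (*-congˡ (sym (ε-transpose p≢q))) (Π.∑-permute {N} (λ u → A u (σ u)) (Perm.transpose p q)) ⟨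
        ε σ * - 1# * ∏[ u < N ] A u (σ u)
          ≈⟨ *-congʳ (trans (*-comm _ _) (-1*x≈-x _)) ⟩
        - ε σ * ∏[ u < N ] A u (σ u)
          ≈⟨ -‿distribˡ-* _ _ ⟨
        - ε∏ A σ
          ∎
      ε∏-collision : ∀ σ → σ p ≡ σ q → ε∏ A σ ≈ 0#
      ε∏-collision σ σp≡σq = trans (*-congʳ (reflexive (ε-nonInjective λ σ-inj → p≢q (σ-inj σp≡σq)))) (zeroˡ _)

    det′-rows : ∀ (B : Fin N → Fin N → C) f → det′ (B ∘ f) ≈ ε f * det′ B
    det′-rows B f with injective? f
    ... | yes f-inj = begin
      ∑ᶠ (ε∏ (B ∘ f))                  ≈⟨ Σ.∑ᶠ-permute (ε∏ (B ∘ f)) (ε∏-cong (B ∘ f)) P ⟨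
      ∑ᶠ (λ τ → ε∏ (B ∘ f) (τ ∘ f))    ≈⟨ ∑ᶠ-cong term ⟩
      ∑ᶠ (λ τ → ε f * ε∏ B τ)          ≈⟨ *-distribˡ-∑ᶠ (ε f) (ε∏ B) ⟨
      ε f * det′ B                     ∎
      where
      P = injective⇒permutation f-inj
      term : ∀ τ → ε∏ (B ∘ f) (τ ∘ f) ≈ ε f * ε∏ B τ
      term τ = begin
        ε (τ ∘ f) * ∏[ t < N ] B (f t) (τ (f t))   ≈⟨ *-cong (sym (ε-∘ τ f)) (Π.∑-permute {N} (λ u → B u (τ u)) P) ⟨
        ε τ * ε f * ∏[ u < N ] B u (τ u)           ≈⟨ *-congʳ (*-comm _ _) ⟩
        ε f * ε τ * ∏[ u < N ] B u (τ u)           ≈⟨ *-assoc _ _ _ ⟩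
        ε f * ε∏ B τ                               ∎
    ... | no ¬f-inj with ¬injective⇒collision ¬f-inj
    ...   | p , q , p≢q , fp≡fq = begin
      det′ (B ∘ f)   ≈⟨ det′-equalRows (B ∘ f) p≢q (λ u → reflexive (≡.cong (λ r → B r u) fp≡fq)) ⟩
      0#             ≈⟨ zeroˡ _ ⟨
      0# * det′ B    ≡⟨ ≡.cong (_* det′ B) (ε-nonInjective ¬f-inj) ⟨
      ε f * det′ B   ∎

    infixl 7 _·_
    _·_ : (Fin N → Fin N → C) → (Fin N → Fin N → C) → Fin N → Fin N → C
    (A · B) t u = ∑[ a < N ] (A t a * B a u)

    det′-· : ∀ A B → det′ (A · B) ≈ det′ A * det′ B
    det′-· A B = begin
      ∑ᶠ (λ σ → ε σ * ∏[ t < N ] ∑[ a < N ] (A t a * B a (σ t)))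
        ≈⟨ ∑ᶠ-cong {N} {N} (λ σ → *-congˡ (∏-∑ (λ t a → A t a * B a (σ t)))) ⟩
      ∑ᶠ (λ σ → ε σ * ∑ᶠ (λ f → ∏[ t < N ] (A t (f t) * B (f t) (σ t))))
        ≈⟨ ∑ᶠ-cong {N} {N} (λ σ → trans (*-distribˡ-∑ᶠ {N} {N} (ε σ) _)
                                        (∑ᶠ-cong {N} {N} λ f → *-congˡ (Π.∑-distrib-+ {N} _ _))) ⟩
      ∑ᶠ (λ σ → ∑ᶠ (λ f → ε σ * (∏A f * ∏B f σ)))
        ≈⟨ Σ.∑ᶠ-comm (λ σ f → ε σ * (∏A f * ∏B f σ)) ⟩
      ∑ᶠ (λ f → ∑ᶠ (λ σ → ε σ * (∏A f * ∏B f σ)))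
        ≈⟨ ∑ᶠ-cong {N} {N} (λ f → trans (∑ᶠ-cong {N} {N} λ σ → x∙yz≈y∙xz _ _ _)
                                        (sym (*-distribˡ-∑ᶠ (∏A f) (ε∏ (B ∘ f))))) ⟩
      ∑ᶠ (λ f → ∏A f * det′ (B ∘ f))
        ≈⟨ ∑ᶠ-cong {N} {N} (λ f → trans (*-congˡ (det′-rows B f)) (x∙yz≈yx∙z _ _ _)) ⟩
      ∑ᶠ (λ f → ε∏ A f * det′ B)
        ≈⟨ *-distribʳ-∑ᶠ (det′ B) (ε∏ A) ⟨
      det′ A * det′ B
        ∎
      where
      ∏A : (Fin N → Fin N) → C
      ∏A f = ∏[ t < N ] A t (f t)
      ∏B : (Fin N → Fin N) → (Fin N → Fin N) → C
      ∏B f σ = ∏[ t < N ] B (f t) (σ t)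

    det-cong : ∀ {A B : Fin N → Fin N → C} → (∀ t u → A t u ≈ B t u) → det R N A ≈ det R N B
    det-cong {A} {B} A≈B = trans (det≈det′ A) (trans (det′-cong A≈B) (sym (det≈det′ B)))

    det-· : ∀ (A B : Fin N → Fin N → C) → det R N (A · B) ≈ det R N A * det R N B
    det-· A B = trans (det≈det′ (A · B)) (trans (det′-· A B) (sym (*-cong (det≈det′ A) (det≈det′ B))))

  module _ {p q} (D : Fin (p ℕ.+ q) → Fin (p ℕ.+ q) → C) (Y : Fin p → Fin p → C) (Z : Fin q → Fin q → C) where

    ε∏-⊕ : (∀ i i′ → D (i ↑ˡ q) (i′ ↑ˡ q) ≈ Y i i′) → (∀ j j′ → D (p ↑ʳ j) (p ↑ʳ j′) ≈ Z j j′) →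
           ∀ g h → ε∏ D (g ⊕ h) ≈ ε∏ Y g * ε∏ Z h
    ε∏-⊕ D≈Y D≈Z g h = begin
      ε (g ⊕ h) * ∏[ a < p ℕ.+ q ] D a ((g ⊕ h) a)
        ≈⟨ *-cong (ε-⊕ g h) (Π.∑-↑ p _) ⟩
      ε g * ε h * (∏[ i < p ] D (i ↑ˡ q) ((g ⊕ h) (i ↑ˡ q)) * ∏[ j < q ] D (p ↑ʳ j) ((g ⊕ h) (p ↑ʳ j)))
        ≈⟨ *-congˡ (*-cong (Π.∑-cong {p} λ i → trans (reflexive (≡.cong (D (i ↑ˡ q)) (⊕-↑ˡ g h i))) (D≈Y i (g i)))
                           (Π.∑-cong {q} λ j → trans (reflexive (≡.cong (D (p ↑ʳ j)) (⊕-↑ʳ g h j))) (D≈Z j (h j)))) ⟩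
      ε g * ε h * (∏[ i < p ] Y i (g i) * ∏[ j < q ] Z j (h j))
        ≈⟨ interchange _ _ _ _ ⟩
      ε∏ Y g * ε∏ Z h
        ∎

    det′-blockDiagonal : (∀ i i′ → D (i ↑ˡ q) (i′ ↑ˡ q) ≈ Y i i′) → (∀ i j → D (i ↑ˡ q) (p ↑ʳ j) ≈ 0#) →
                         (∀ j i → D (p ↑ʳ j) (i ↑ˡ q) ≈ 0#) → (∀ j j′ → D (p ↑ʳ j) (p ↑ʳ j′) ≈ Z j j′) →
                         det′ D ≈ det′ Y * det′ Z
    det′-blockDiagonal D≈Y D≈0 D≈0′ D≈Z = begin
      ∑ᶠ (ε∏ D)
        ≈⟨ Σ.∑ᶠ-++ p (ε∏ D) (ε∏-cong D) ⟩
      ∑ᶠ {p ℕ.+ q} {p} (λ g → ∑ᶠ {p ℕ.+ q} {q} (λ h → ε∏ D (g ++ᵥ h)))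
        ≈⟨ Σ.∑ᶠ-restrict (_↑ˡ q) InRight restrictˡ G-cong G≈0 ⟩
      ∑ᶠ {p} {p} (λ g → ∑ᶠ {p ℕ.+ q} {q} (λ h → ε∏ D (((_↑ˡ q) ∘ g) ++ᵥ h)))
        ≈⟨ ∑ᶠ-cong {p} {p} (λ g → Σ.∑ᶠ-restrict (p ↑ʳ_) InLeft restrictʳ (H-cong g) (H≈0 g)) ⟩
      ∑ᶠ {p} {p} (λ g → ∑ᶠ {q} {q} (λ h → ε∏ D (g ⊕ h)))
        ≈⟨ ∑ᶠ-cong {p} {p} (λ g → ∑ᶠ-cong {q} {q} (ε∏-⊕ D≈Y D≈Z g)) ⟩
      ∑ᶠ {p} {p} (λ g → ∑ᶠ {q} {q} (λ h → ε∏ Y g * ε∏ Z h))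
        ≈⟨ ∑ᶠ-cong {p} {p} (λ g → *-distribˡ-∑ᶠ (ε∏ Y g) (ε∏ Z)) ⟨
      ∑ᶠ (λ g → ε∏ Y g * det′ Z)
        ≈⟨ *-distribʳ-∑ᶠ (det′ Z) (ε∏ Y) ⟨
      det′ Y * det′ Z
        ∎
      where
      InRight InLeft : Fin (p ℕ.+ q) → Set
      InRight x = ∃ λ j → x ≡ p ↑ʳ j
      InLeft  x = ∃ λ i → x ≡ i ↑ˡ q
      restrictˡ : ∀ {H} → (∀ x → InRight x → H x ≈ 0#) → sum H ≈ sum (H ∘ (_↑ˡ q))
      restrictˡ {H} H≈0 = trans (Σ.∑-↑ p H) (trans (+-congˡ (Σ.∑-zero λ j → H≈0 _ (j , ≡.refl))) (+-identityʳ _))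
      restrictʳ : ∀ {H} → (∀ x → InLeft x → H x ≈ 0#) → sum H ≈ sum (H ∘ (p ↑ʳ_))
      restrictʳ {H} H≈0 = trans (Σ.∑-↑ p H) (trans (+-congʳ (Σ.∑-zero λ i → H≈0 _ (i , ≡.refl))) (+-identityˡ _))
      G-cong : (λ g → ∑ᶠ {p ℕ.+ q} {q} (λ h → ε∏ D (g ++ᵥ h))) Preserves _≗_ ⟶ _≈_
      G-cong g≗g′ = ∑ᶠ-cong {p ℕ.+ q} {q} λ h → ε∏-cong D (++-cong _ _ g≗g′ (λ _ → ≡.refl))
      G≈0 : ∀ g i → InRight (g i) → ∑ᶠ {p ℕ.+ q} {q} (λ h → ε∏ D (g ++ᵥ h)) ≈ 0#
      G≈0 g i (j , gi≡p↑j) = Σ.∑ᶠ-zero {p ℕ.+ q} {q} λ h → trans (*-congˡ (∏-zero (λ a → D a ((g ++ᵥ h) a)) (i ↑ˡ q)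
        (trans (reflexive (≡.cong (D (i ↑ˡ q)) (≡.trans (lookup-++ˡ g h i) gi≡p↑j))) (D≈0 i j)))) (zeroʳ _)
      H-cong : ∀ g → (λ h → ε∏ D (((_↑ˡ q) ∘ g) ++ᵥ h)) Preserves _≗_ ⟶ _≈_
      H-cong g h≗h′ = ε∏-cong D (++-cong _ _ (λ _ → ≡.refl) h≗h′)
      H≈0 : ∀ g h j → InLeft (h j) → ε∏ D (((_↑ˡ q) ∘ g) ++ᵥ h) ≈ 0#
      H≈0 g h j (i , hj≡i↑q) = trans (*-congˡ (∏-zero (λ a → D a ((((_↑ˡ q) ∘ g) ++ᵥ h) a)) (p ↑ʳ j)
        (trans (reflexive (≡.cong (D (p ↑ʳ j)) (≡.trans (lookup-++ʳ ((_↑ˡ q) ∘ g) h j) hj≡i↑q))) (D≈0′ j i)))) (zeroʳ _)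

  -- I_k ⊗ X, with Fin (k * n) read as (block , position) through remQuot
  kron : ∀ k {n} → (Fin n → Fin n → C) → Fin (k ℕ.* n) → Fin (k ℕ.* n) → C
  kron k {n} X a b = δ R (proj₁ (remQuot {k} n a)) (proj₁ (remQuot {k} n b)) * X (proj₂ (remQuot {k} n a)) (proj₂ (remQuot {k} n b))

  det′-kron : ∀ k {n} (X : Fin n → Fin n → C) → det′ (kron k X) ≈ pow R (det′ X) k
  det′-kron zero        X = *-identityˡ 1#
  det′-kron (suc k) {n} X = begin
    det′ (kron (suc k) X)       ≈⟨ det′-blockDiagonal (kron (suc k) X) X (kron k X) X-block 0-block 0-block′ kron-block ⟩
    det′ X * det′ (kron k X)    ≈⟨ *-congˡ (det′-kron k X) ⟩
    det′ X * pow R (det′ X) k   ∎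
    where
    kron-at : ∀ {a b u v} → remQuot {suc k} n a ≡ u → remQuot {suc k} n b ≡ v →
              kron (suc k) X a b ≈ δ R (proj₁ u) (proj₁ v) * X (proj₂ u) (proj₂ v)
    kron-at ≡.refl ≡.refl = refl
    X-block : ∀ i i′ → kron (suc k) X (i ↑ˡ (k ℕ.* n)) (i′ ↑ˡ (k ℕ.* n)) ≈ X i i′
    X-block i i′ = trans (kron-at (remQuot-↑ˡ n i) (remQuot-↑ˡ n i′)) (*-identityˡ _)
    0-block : ∀ i j → kron (suc k) X (i ↑ˡ (k ℕ.* n)) (n ↑ʳ j) ≈ 0#
    0-block i j = trans (kron-at (remQuot-↑ˡ n i) (remQuot-↑ʳ n j)) (zeroˡ _)
    0-block′ : ∀ j i → kron (suc k) X (n ↑ʳ j) (i ↑ˡ (k ℕ.* n)) ≈ 0#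
    0-block′ j i = trans (kron-at (remQuot-↑ʳ n j) (remQuot-↑ˡ n i)) (zeroˡ _)
    kron-block : ∀ j j′ → kron (suc k) X (n ↑ʳ j) (n ↑ʳ j′) ≈ kron k X j j′
    kron-block j j′ = trans (kron-at (remQuot-↑ʳ n j) (remQuot-↑ʳ n j′)) (*-congʳ (reflexive (δ-suc _ _)))

  det-kron : ∀ k {n} (X : Fin n → Fin n → C) → det R (k ℕ.* n) (kron k X) ≈ pow R (det R n X) k
  det-kron k X = trans (det≈det′ (kron k X)) (trans (det′-kron k X) (pow-cong k (sym (det≈det′ X))))

  -- The hyperdeterminant and the hypermatrix M_X

  module _ {m N : ℕ} where

    slice : ((Fin (suc m) → Fin N) → C) → (Fin m → Fin N → Fin N) → Fin N → Fin N → C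
    slice T ρ t a = T ((λ k → ρ k t) ∷ʳ a)

    detdN!-slices : ∀ (T : (Fin (suc m) → Fin N) → C) → T Preserves _≗_ ⟶ _≈_ →
                    detdN! R (suc m) N T ≈ ∑ₗ (allFunsL m (perms N)) (λ ρ → ∏[ k < m ] sgn R (ρ k) * det R N (slice T ρ))
    detdN!-slices T T-cong = begin
      ∑ₗ (allFunsL (suc m) (perms N)) F
        ≈⟨ Σ.∑ₗ-allFunsL-∷ʳ m (perms N) F-cong ⟩
      ∑ₗ (allFunsL m (perms N)) (λ ρ → ∑ₗ (perms N) (λ σ → F (ρ ∷ʳ σ)))
        ≈⟨ ∑ₗ-cong (allFunsL m (perms N)) (λ ρ → trans (∑ₗ-cong (perms N) (term ρ)) (sym (*-distribˡ-∑ₗ _ (perms N) _))) ⟩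
      ∑ₗ (allFunsL m (perms N)) (λ ρ → ∏[ k < m ] sgn R (ρ k) * det R N (slice T ρ))
        ∎
      where
      F : (Fin (suc m) → Fin N → Fin N) → C
      F σs = prodFin R (suc m) (λ k → sgn R (σs k)) * prodFin R N (λ i → T (λ k → σs k i))
      F-cong : F Preserves _≗_ ⟶ _≈_
      F-cong σs≗σs′ = *-cong (prodFin-cong (suc m) λ k → reflexive (≡.cong (sgn R) (σs≗σs′ k)))
                             (prodFin-cong N λ i → T-cong λ k → ≡.cong (λ σ → σ i) (σs≗σs′ k))
      term : ∀ ρ σ → F (ρ ∷ʳ σ) ≈ ∏[ k < m ] sgn R (ρ k) * (sgn R σ * prodFin R N (λ i → slice T ρ i (σ i)))
      term ρ σ = begin
        prodFin R (suc m) (λ k → sgn R ((ρ ∷ʳ σ) k)) * prodFin R N (λ i → T (λ k → (ρ ∷ʳ σ) k i))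
          ≈⟨ *-cong (trans (reflexive (prodFin≡∏ (suc m) sgns)) (Π.sum-init-last {m} sgns))
                    (prodFin-cong N λ i → T-cong (∘-∷ʳ (λ σ → σ i) ρ σ)) ⟩
        ∏[ k < m ] sgn R ((ρ ∷ʳ σ) (inject₁ k)) * sgn R ((ρ ∷ʳ σ) (fromℕ m)) * prodFin R N (λ i → slice T ρ i (σ i))
          ≈⟨ *-congʳ (*-cong (Π.∑-cong {m} λ k → reflexive (≡.cong (sgn R) (init-∷ʳ ρ σ k)))
                             (reflexive (≡.cong (sgn R) (last-∷ʳ ρ σ)))) ⟩
        ∏[ k < m ] sgn R (ρ k) * sgn R σ * prodFin R N (λ i → slice T ρ i (σ i))
          ≈⟨ *-assoc _ _ _ ⟩
        ∏[ k < m ] sgn R (ρ k) * (sgn R σ * prodFin R N (λ i → slice T ρ i (σ i)))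
          ∎
        where
        sgns : Fin (suc m) → C
        sgns k = sgn R ((ρ ∷ʳ σ) k)

    detdN!-lastMode : ∀ (T T′ : (Fin (suc m) → Fin N) → C) (B : Fin N → Fin N → C) →
                      T Preserves _≗_ ⟶ _≈_ → T′ Preserves _≗_ ⟶ _≈_ →
                      (∀ w b → T′ (w ∷ʳ b) ≈ ∑[ a < N ] (T (w ∷ʳ a) * B a b)) →
                      detdN! R (suc m) N T′ ≈ detdN! R (suc m) N T * det R N B
    detdN!-lastMode T T′ B T-cong T′-cong T′≈T·B = begin
      detdN! R (suc m) N T′
        ≈⟨ detdN!-slices T′ T′-cong ⟩
      ∑ₗ ρs (λ ρ → sgns ρ * det R N (slice T′ ρ))
        ≈⟨ ∑ₗ-cong ρs (λ ρ → *-congˡ (trans (det-cong (λ t b → T′≈T·B _ b)) (det-· (slice T ρ) B))) ⟩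
      ∑ₗ ρs (λ ρ → sgns ρ * (det R N (slice T ρ) * det R N B))
        ≈⟨ ∑ₗ-cong ρs (λ ρ → *-assoc _ _ _) ⟨
      ∑ₗ ρs (λ ρ → sgns ρ * det R N (slice T ρ) * det R N B)
        ≈⟨ *-distribʳ-∑ₗ (det R N B) ρs _ ⟨
      ∑ₗ ρs (λ ρ → sgns ρ * det R N (slice T ρ)) * det R N B
        ≈⟨ *-congʳ (detdN!-slices T T-cong) ⟨
      detdN! R (suc m) N T * det R N B
        ∎
      where
      ρs = allFunsL m (perms N)
      sgns : (Fin m → Fin N → Fin N) → C
      sgns ρ = ∏[ k < m ] sgn R (ρ k)

  module _ (m n : ℕ) where

    row col : Fin (n ℕ.* n) → Fin n
    row a = proj₁ (pairOf n a)
    col a = proj₂ (pairOf n a)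

    MX-cong : ∀ {d} Y → MX R d n Y Preserves _≗_ ⟶ _≈_
    MX-cong {d} Y v≗v′ =
      *-cong (prodFin-cong d λ k → reflexive (≡.cong₂ (λ x y → δ R (col x) (row y)) (v≗v′ (inject₁ k)) (v≗v′ (suc k))))
             (reflexive (≡.cong₂ (λ x y → Y (row x) (col y)) (v≗v′ zero) (v≗v′ (fromℕ d))))

    chain : (Fin (suc m) → Fin (n ℕ.* n)) → C
    chain w = ∏[ k < m ] δ R (col (w (inject₁ k))) (row (w (suc k)))

    MX-∷ʳ : ∀ Y (w : Fin (suc m) → Fin (n ℕ.* n)) a →
            MX R (suc m) n Y (w ∷ʳ a) ≈ chain w * δ R (col (last w)) (row a) * Y (row (w zero)) (col a)
    MX-∷ʳ Y w a = begin
      prodFin R (suc m) links * Y (row (w zero)) (col ((w ∷ʳ a) (fromℕ (suc m))))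
        ≈⟨ *-cong (trans (reflexive (prodFin≡∏ (suc m) links)) (Π.sum-init-last {m} links))
                  (reflexive (≡.cong (Y (row (w zero)) ∘ col) (last-∷ʳ w a))) ⟩
      ∏[ k < m ] links (inject₁ k) * links (fromℕ m) * Y (row (w zero)) (col a)
        ≈⟨ *-congʳ (*-cong (Π.∑-cong {m} λ k → reflexive (≡.cong₂ δ-link (init-∷ʳ w a (inject₁ k)) (init-∷ʳ w a (suc k))))
                           (reflexive (≡.cong₂ δ-link (init-∷ʳ w a (fromℕ m)) (last-∷ʳ w a)))) ⟩
      chain w * δ R (col (last w)) (row a) * Y (row (w zero)) (col a)
        ∎
      where
      δ-link : Fin (n ℕ.* n) → Fin (n ℕ.* n) → C
      δ-link x y = δ R (col x) (row y)
      links : Fin (suc m) → C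
      links k = δ-link ((w ∷ʳ a) (inject₁ k)) ((w ∷ʳ a) (suc k))

    MX-lastMode : ∀ X (w : Fin (suc m) → Fin (n ℕ.* n)) b →
                  MX R (suc m) n X (w ∷ʳ b) ≈ ∑[ a < n ℕ.* n ] (MX R (suc m) n (idMat R n) (w ∷ʳ a) * kron n X a b)
    MX-lastMode X w b = sym (begin
      ∑[ a < n ℕ.* n ] (MX R (suc m) n (idMat R n) (w ∷ʳ a) * kron n X a b)
        ≈⟨ ∑-cong {n ℕ.* n} (λ a → *-congʳ (MX-∷ʳ (idMat R n) w a)) ⟩
      ∑[ a < n ℕ.* n ] G (remQuot n a)
        ≈⟨ Σ.∑-combine n (G ∘ remQuot n) ⟩
      ∑[ x < n ] ∑[ y < n ] G (remQuot n (combine x y))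
        ≈⟨ ∑-cong {n} (λ x → ∑-cong {n} λ y → trans (reflexive (≡.cong G (remQuot-combine x y))) (regroup x y)) ⟩
      ∑[ x < n ] ∑[ y < n ] (δ R J x * (δ R I y * H x y))
        ≈⟨ ∑-cong {n} (λ x → *-distribˡ-sum {n} (δ R J x) _) ⟨
      ∑[ x < n ] (δ R J x * ∑[ y < n ] (δ R I y * H x y))
        ≈⟨ ∑-cong {n} (λ x → *-congˡ (∑-δ I (H x))) ⟩
      ∑[ x < n ] (δ R J x * H x I)
        ≈⟨ ∑-δ J (λ x → H x I) ⟩
      H J I
        ≈⟨ MX-∷ʳ X w b ⟨
      MX R (suc m) n X (w ∷ʳ b)
        ∎)
      where
      J = col (last w)
      I = row (w zero)
      G : Fin n × Fin n → C
      G p = chain w * δ R J (proj₁ p) * δ R I (proj₂ p) * (δ R (proj₁ p) (row b) * X (proj₂ p) (col b))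
      H : Fin n → Fin n → C
      H x y = chain w * δ R x (row b) * X y (col b)
      regroup : ∀ x y → G (x , y) ≈ δ R J x * (δ R I y * H x y)
      regroup x y = solve 5 (λ c j i d e → ((c ∙ₑ j) ∙ₑ i) ∙ₑ (d ∙ₑ e) ⊜ j ∙ₑ (i ∙ₑ ((c ∙ₑ d) ∙ₑ e))) refl
                            (chain w) (δ R J x) (δ R I y) (δ R x (row b)) (X y (col b))

  detdN!-MX : ∀ m n (X : Fin n → Fin n → C) →
              detdN! R (suc (suc m)) (n ℕ.* n) (MX R (suc m) n X)
                ≈ pow R (det R n X) n * detdN! R (suc (suc m)) (n ℕ.* n) (MX R (suc m) n (idMat R n))
  detdN!-MX m n X = begin
    detdN! R (suc (suc m)) (n ℕ.* n) (MX R (suc m) n X)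
      ≈⟨ detdN!-lastMode _ _ (kron n X) (MX-cong m n (idMat R n)) (MX-cong m n X) (MX-lastMode m n X) ⟩
    detdN! R (suc (suc m)) (n ℕ.* n) (MX R (suc m) n (idMat R n)) * det R (n ℕ.* n) (kron n X)
      ≈⟨ *-congˡ (det-kron n X) ⟩
    detdN! R (suc (suc m)) (n ℕ.* n) (MX R (suc m) n (idMat R n)) * pow R (det R n X) n
      ≈⟨ *-comm _ _ ⟩
    pow R (det R n X) n * detdN! R (suc (suc m)) (n ℕ.* n) (MX R (suc m) n (idMat R n))
      ∎

open import Data.Nat using (_*_)
open import Data.Nat.Divisibility using (_∣_; ∣⇒≤)

lemma4p1 : ∀ {c ℓ} (R : CommutativeRing c ℓ) (m n : ℕ) → 2 ∣ suc m →
    (X : Fin n → Fin n → CommutativeRing.Carrier R) →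
    CommutativeRing._≈_ R
      (detdN! R (suc m) (n * n) (MX R m n X))
      (CommutativeRing._*_ R (pow R (det R n X) n) (detdN! R (suc m) (n * n) (MX R m n (idMat R n))))
lemma4p1 R zero    n 2∣1 X = ⊥-elim (ℕ.<-irrefl ≡.refl (∣⇒≤ 2∣1))
lemma4p1 R (suc m) n _   X = Determinants.detdN!-MX R m n X
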